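{- Let $a,b,k$ be non-negative integers with $2a+2b\le k$. Let $\mathcal{X}^e_{a,b,k}$ be the set of pairs $(\boldsymbol\lambda,\mathrm{fs}_{ -1}(\boldsymbol\lambda))$ where $\boldsymbol\lambda=(\lambda^{(1)},\dots,\lambda^{(k)})$ is a $k$-tuple of partitions such that, for every $m\in\{1,\dots,k\}$, $\lambda^{(m)}$ has only even parts and each part of $\lambda^{(m)}$ is at least $m+\max\{m-2a,0\}+\max\{m-(k-2b),0\}$. Then \[ \sum_{(\boldsymbol\lambda,\mathrm{fs}_{ -1}(\boldsymbol\lambda))\in\mathcal{X}^e_{a,b,k}}q^{|(\boldsymbol\lambda,\mathrm{fs}_{ -1}(\boldsymbol\lambda))|} =\sum_{s_1\ge\cdots\ge s_k\ge0}\frac{q^{\,s_1^2+\cdots+s_k^2-2\sum_{i=1}^{a}s_{2i}+2\sum_{i=1}^{b}s_{k-2b+2i-1}}}{(q^2;q^2)_{s_1-s_2}\cdots(q^2;q^2)_{s_{k-1}-s_k}(q^2;q^2)_{s_k}}. \]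
   Context: Partitions are finite (possibly empty) non-increasing sequences of non-negative integers; $|\lambda|$ is the sum of the parts. A generalised frequency sequence is a sequence $(f_i)_{i\in\mathbb Z}$ of non-negative integers with finitely many non-zero terms ($f_i$ = multiplicity of the integer $i$, which may be negative), of weight $|f|=\sum_i if_i$. For a $k$-tuple $\boldsymbol\lambda$ of partitions, let $\ell_m$ be the number of parts of $\lambda^{(m)}$ and $s_m=\ell_m+\cdots+\ell_k$; for $u\in\mathbb Z$, the $u$-frame sequence $\mathrm{fs}_u(\boldsymbol\lambda)$ is the generalised frequency sequence $f$ with $f_{u+2t}=\#\{m: s_m>t\}$ for $0\le t<s_1$ and all other entries $0$ (from index $u$: $s_k$ pairs $(k,0)$, then $s_{k-1}-s_k$ pairs $(k-1,0)$, …, $s_1-s_2$ pairs $(1,0)$). The weight of a pair is $|(\boldsymbol\lambda,f)|=|\lambda^{(1)}|+\cdots+|\lambda^{(k)}|+|f|$. $(a;q)_n=\prod_{t=0}^{n-1}(1-aq^t)$. -}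

module Defs where

open import Data.Nat as ℕ using (ℕ; zero; suc; _∸_; _≥_; _≤_)
open import Data.Nat.Divisibility using (_∣_; _∣?_)
open import Data.Integer as ℤ using (ℤ; +_; -[1+_]; ∣_∣)
open import Data.List using (List; []; _∷_; map; foldr; upTo; length; filter; concatMap; drop)
open import Data.Nat.ListAction using (sum)
open import Data.List.Relation.Unary.All using (All)
open import Data.List.Relation.Unary.Linked using (Linked)
open import Data.Vec as V using (Vec)
open import Data.Fin using (Fin; toℕ)
open import Data.Product using (_×_; _,_)
open import Data.Bool using (if_then_else_)
open import Relation.Nullary using (does)

IsPartition : List ℕ → Set
IsPartition = Linked _≥_

size : List ℕ → ℕ
size = sum

oneTo : ℕ → List ℕ
oneTo n = map suc (upTo n)

-- k-tuples of partitions, λ^(m) = lookup λs (m-1).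

Tuple : ℕ → Set
Tuple k = Vec (List ℕ) k

-- s_m = ℓ_m + ... + ℓ_k   (m is 1-indexed; s_m = 0 for m > k)
sAt : ∀ {k} → Tuple k → ℕ → ℕ
sAt λs m = sum (drop (m ∸ 1) (map length (V.toList λs)))

-- the u-frame sequence fs_u(λ), as the list of its (possibly) non-zero
-- entries (index , multiplicity):  f_{u+2t} = #{m ∈ 1..k : s_m > t}, 0 ≤ t < s_1
fs : ∀ {k} → ℤ → Tuple k → List (ℤ × ℕ)
fs {k} u λs =
  map (λ t → (u ℤ.+ (+ (2 ℕ.* t))) , length (filter (λ m → t ℕ.<? sAt λs m) (oneTo k)))
      (upTo (sAt λs 1))

fsWeight : List (ℤ × ℕ) → ℤ
fsWeight = foldr (λ { (i , f) acc → i ℤ.* (+ f) ℤ.+ acc }) (+ 0)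

weight : ∀ {k} → Tuple k → ℤ
weight λs = (+ sum (map size (V.toList λs))) ℤ.+ fsWeight (fs -[1+ 0 ] λs)

lowerBound : ℕ → ℕ → ℕ → ℕ → ℕ
lowerBound a b k m = m ℕ.+ (m ∸ 2 ℕ.* a) ℕ.+ (m ∸ (k ∸ 2 ℕ.* b))

-- λs gives an element (λs, fs_{-1}(λs)) of X^e_{a,b,k}
InX : (a b k : ℕ) → Tuple k → Set
InX a b k λs = (i : Fin k) →
  let p = V.lookup λs i ; m = suc (toℕ i) in
  IsPartition p × All (λ x → (2 ∣ x) × (lowerBound a b k m ≤ x)) p

-- Formal power series in q with ℕ coefficients: n ↦ coefficient of q^n.

Series : Set
Series = ℕ → ℕ

oneS : Series
oneS zero = 1
oneS (suc _) = 0

_⊛_ : Series → Series → Series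
(f ⊛ g) n = sum (map (λ i → f i ℕ.* g (n ∸ i)) (upTo (suc n)))

-- 1/(1 - q^j) = Σ_{r ≥ 0} q^{j r}   (used with j ≥ 1)
geomS : ℕ → Series
geomS j n = if does (j ∣? n) then 1 else 0

-- 1/(q^2;q^2)_d = Π_{t=0}^{d-1} 1/(1 - q^{2+2t})
invPoch2 : ℕ → Series
invPoch2 d = foldr _⊛_ oneS (map (λ t → geomS (2 ℕ.* suc t)) (upTo d))

-- non-increasing sequences s_1 ≥ ... ≥ s_k ≥ 0 with s_1 ≤ M
chains : ℕ → ℕ → List (List ℕ)
chains zero M = [] ∷ []
chains (suc k) M = concatMap (λ x → map (x ∷_) (chains k x)) (upTo (suc M))

-- 1-indexed access, 0 outside the list
at : List ℕ → ℕ → ℕ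
at [] _ = 0
at (x ∷ xs) zero = 0
at (x ∷ xs) (suc zero) = x
at (x ∷ xs) (suc (suc i)) = at xs (suc i)

expo : ℕ → ℕ → ℕ → List ℕ → ℤ
expo a b k s =
  (+ sum (map (λ i → at s i ℕ.* at s i) (oneTo k)))
  ℤ.- (+ (2 ℕ.* sum (map (λ i → at s (2 ℕ.* i)) (oneTo a))))
  ℤ.+ (+ (2 ℕ.* sum (map (λ i → at s ((k ∸ 2 ℕ.* b) ℕ.+ 2 ℕ.* i ∸ 1)) (oneTo b))))

diffs : ℕ → List ℕ → List ℕ
diffs k s = map (λ j → at s j ∸ at s (suc j)) (oneTo k)

-- coefficient of q^n in  q^E · P(q)
shiftCoeff : ℤ → Series → ℤ → ℕ
shiftCoeff E P n = if does (E ℤ.≤? n) then P ∣ n ℤ.- E ∣ else 0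

-- coefficient of q^n in the summand indexed by s
termCoeff : ℕ → ℕ → ℕ → List ℕ → ℤ → ℕ
termCoeff a b k s n =
  shiftCoeff (expo a b k s) (foldr _⊛_ oneS (map invPoch2 (diffs k s))) n

-- coefficient of q^n in the right-hand sum restricted to s_1 ≤ M
rhsTrunc : ℕ → ℕ → ℕ → ℕ → ℤ → ℕ
rhsTrunc a b k M n = sum (map (λ s → termCoeff a b k s n) (chains k M))

{-# OPTIONS --safe #-}

-- Write ℓ_m for the number of parts of λ^(m) and s_m = ℓ_m + ⋯ + ℓ_k. A partition into ℓ even
-- parts ≥ β is determined by its halved gaps r_0, …, r_{ℓ-1}, which are arbitrary: with e the
-- least even number ≥ β, its size is e ℓ + Σ_t 2(t+1) r_t, and 1/(q²;q²)_ℓ counts gap lists by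
-- that grade. The frame sequence contributes Σ_m s_m² − 2 Σ_m s_m, and summation by parts turns
-- Σ_m e_m ℓ_m into Σ_m (e_m − e_{m-1}) s_m. For the lower bounds β_m of the theorem the
-- increments e_m − e_{m-1} are 2,0,2,0,… up to 2a, then 2 up to k − 2b, then 4,2,4,2,…, which
-- is exactly what the exponent of the summand indexed by s records. So the tuples of weight n
-- correspond to the pairs (s, gap lists) counted by the coefficient of q^n; as the exponent is
-- at least 2 s_1 − k, only chains with s_1 ≤ |n| + k contribute, which makes both sides finite.

module Submission where

open import Defs

open import Data.Bool using (if_then_else_; true; false)
open import Data.Empty using (⊥; ⊥-elim)
open import Data.Fin using (Fin; toℕ) renaming (zero to fzero; suc to fsuc)
open import Data.Integer as ℤ using (ℤ; -[1+_]; ∣_∣)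
import Data.Integer.Properties as ℤP
import Data.Integer.Tactic.RingSolver as ℤ-Solver
open import Data.List
  using (List; []; _∷_; [_]; _++_; _∷ʳ_; map; foldr; upTo; applyUpTo; length; filter; concatMap; drop)
open import Data.List.Membership.Propositional using (_∈_; find; lose)
open import Data.List.Membership.Propositional.Properties
  using (∈-map⁺; ∈-map⁻; ∈-concatMap⁺; ∈-concatMap⁻; ∈-upTo⁺; ∈-upTo⁻)
open import Data.List.Properties
  using (map-++; map-∘; map-cong-local; map-upTo; upTo-∷ʳ; length-++; length-map; length-upTo; ∷-injective; ∷-injectiveʳ)
open import Data.List.Relation.Binary.Pointwise using (Pointwise; []; _∷_)
open import Data.List.Relation.Binary.Pointwise.Properties using (Pointwise-length)
open import Data.List.Relation.Unary.All as All using (All; []; _∷_)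
import Data.List.Relation.Unary.All.Properties as AllP
open import Data.List.Relation.Unary.AllPairs using ([]; _∷_)
open import Data.List.Relation.Unary.Any using (here; there)
open import Data.List.Relation.Unary.Linked using ([]; [-]; _∷_)
open import Data.List.Relation.Unary.Unique.Propositional using (Unique)
import Data.List.Relation.Unary.Unique.Propositional.Properties as Unique
open import Data.Nat as ℕ using (ℕ; zero; suc; _+_; _*_; _∸_; _≤_; _<_; z≤n; s≤s; _<?_; ⌈_/2⌉; ⌊_/2⌋; NonZero)
open import Data.Nat.Divisibility using (_∣_; _∣?_; divides; ∣m+n∣m⇒∣n; ∣m∣n⇒∣m+n; m∣m*n)
open import Data.Nat.DivMod using (_/_; m*n/n≡m; m*[n/m]≡n)
open import Data.Nat.ListAction using (sum)
open import Data.Nat.ListAction.Properties using (sum-++)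
open import Data.Nat.Properties
import Data.Nat.Tactic.RingSolver as ℕ-Solver
open import Data.Product using (Σ; ∃; ∃₂; _×_; _,_; proj₁; proj₂)
open import Data.Unit using (⊤; tt)
import Data.Vec as V
import Data.Vec.Properties as VecP
open import Function using (_∘_)
open import Function.Bundles using (_⇔_; mk⇔; Equivalence)
open import Relation.Binary.PropositionalEquality hiding ([_])
open import Relation.Nullary using (Dec; yes; no; does)
open import Relation.Nullary.Decidable using (dec-true; dec-false)
open import Relation.Nullary.Negation using (contradiction)
open import Relation.Unary using (Decidable)

open import Algebra.Properties.CommutativeSemigroup +-commutativeSemigroup using () renaming (interchange to +-interchange)

open ≡-Reasoning

∑< : ℕ → (ℕ → ℕ) → ℕ
∑< zero    f = 0
∑< (suc n) f = ∑< n f + f n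

syntax ∑< n (λ i → e) = ∑[ i < n ] e

module _ {f g : ℕ → ℕ} where

  ∑-cong-< : ∀ n → (∀ i → i < n → f i ≡ g i) → ∑< n f ≡ ∑< n g
  ∑-cong-< zero    _  = refl
  ∑-cong-< (suc n) eq = cong₂ _+_ (∑-cong-< n (λ i i<n → eq i (m<n⇒m<1+n i<n))) (eq n ≤-refl)

  ∑-cong : ∀ n → (∀ i → f i ≡ g i) → ∑< n f ≡ ∑< n g
  ∑-cong n eq = ∑-cong-< n (λ i _ → eq i)

  ∑-distrib-+ : ∀ n → ∑[ i < n ] (f i + g i) ≡ ∑< n f + ∑< n g
  ∑-distrib-+ zero    = refl
  ∑-distrib-+ (suc n) = begin
    ∑[ i < n ] (f i + g i) + (f n + g n) ≡⟨ cong (_+ (f n + g n)) (∑-distrib-+ n) ⟩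
    ∑< n f + ∑< n g + (f n + g n)        ≡⟨ +-interchange (∑< n f) (∑< n g) (f n) (g n) ⟩
    ∑< n f + f n + (∑< n g + g n)        ∎

  ∑-mono-≤ : ∀ n → (∀ i → f i ≤ g i) → ∑< n f ≤ ∑< n g
  ∑-mono-≤ zero    _  = z≤n
  ∑-mono-≤ (suc n) le = +-mono-≤ (∑-mono-≤ n le) (le n)

∑-distribˡ-* : ∀ c (f : ℕ → ℕ) n → ∑[ i < n ] (c * f i) ≡ c * ∑< n f
∑-distribˡ-* c f zero    = sym (*-zeroʳ c)
∑-distribˡ-* c f (suc n) = trans (cong (_+ c * f n) (∑-distribˡ-* c f n)) (sym (*-distribˡ-+ c (∑< n f) (f n)))

∑-const : ∀ n c → ∑[ _ < n ] c ≡ n * c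
∑-const zero    c = refl
∑-const (suc n) c = trans (cong (_+ c) (∑-const n c)) (+-comm (n * c) c)

∑-suc : ∀ (f : ℕ → ℕ) n → ∑< (suc n) f ≡ f 0 + ∑[ i < n ] f (suc i)
∑-suc f zero    = +-comm 0 (f 0)
∑-suc f (suc n) = trans (cong (_+ f (suc n)) (∑-suc f n)) (+-assoc (f 0) _ _)

∑-+ : ∀ (f : ℕ → ℕ) m n → ∑< (m + n) f ≡ ∑< m f + ∑[ i < n ] f (m + i)
∑-+ f m zero    = trans (cong (λ l → ∑< l f) (+-identityʳ m)) (sym (+-identityʳ _))
∑-+ f m (suc n) = begin
  ∑< (m + suc n) f                               ≡⟨ cong (λ l → ∑< l f) (+-suc m n) ⟩
  ∑< (m + n) f + f (m + n)                       ≡⟨ cong (_+ f (m + n)) (∑-+ f m n) ⟩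
  ∑< m f + ∑[ i < n ] f (m + i) + f (m + n)      ≡⟨ +-assoc (∑< m f) _ _ ⟩
  ∑< m f + ∑[ i < suc n ] f (m + i)              ∎

∑-pairs : ∀ (f : ℕ → ℕ) n → ∑< (2 * n) f ≡ ∑[ i < n ] (f (2 * i) + f (suc (2 * i)))
∑-pairs f zero    = refl
∑-pairs f (suc n) = begin
  ∑< (2 * suc n) f                                         ≡⟨ cong (λ l → ∑< l f) (*-suc 2 n) ⟩
  ∑< (2 * n) f + f (2 * n) + f (suc (2 * n))               ≡⟨ +-assoc (∑< (2 * n) f) _ _ ⟩
  ∑< (2 * n) f + (f (2 * n) + f (suc (2 * n)))             ≡⟨ cong (_+ (f (2 * n) + f (suc (2 * n)))) (∑-pairs f n) ⟩
  ∑[ i < suc n ] (f (2 * i) + f (suc (2 * i)))             ∎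

∑-pairs-cong : ∀ (f g h₁ h₂ : ℕ → ℕ) n →
  (∀ i → i < n → f (2 * i) + f (suc (2 * i)) + h₁ i ≡ g (2 * i) + g (suc (2 * i)) + h₂ i) →
  ∑< (2 * n) f + ∑< n h₁ ≡ ∑< (2 * n) g + ∑< n h₂
∑-pairs-cong f g h₁ h₂ n pairwise = begin
  ∑< (2 * n) f + ∑< n h₁                                   ≡⟨ cong (_+ ∑< n h₁) (∑-pairs f n) ⟩
  ∑[ i < n ] (f (2 * i) + f (suc (2 * i))) + ∑< n h₁       ≡⟨ ∑-distrib-+ n ⟨
  ∑[ i < n ] (f (2 * i) + f (suc (2 * i)) + h₁ i)          ≡⟨ ∑-cong-< n pairwise ⟩
  ∑[ i < n ] (g (2 * i) + g (suc (2 * i)) + h₂ i)          ≡⟨ ∑-distrib-+ n ⟩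
  ∑[ i < n ] (g (2 * i) + g (suc (2 * i))) + ∑< n h₂       ≡⟨ cong (_+ ∑< n h₂) (∑-pairs g n) ⟨
  ∑< (2 * n) g + ∑< n h₂                                   ∎

∑-comm : ∀ (f : ℕ → ℕ → ℕ) m n → ∑[ i < m ] ∑[ j < n ] f i j ≡ ∑[ j < n ] ∑[ i < m ] f i j
∑-comm f zero    n = sym (trans (∑-const n 0) (*-zeroʳ n))
∑-comm f (suc m) n = begin
  ∑[ i < m ] ∑[ j < n ] f i j + ∑[ j < n ] f m j ≡⟨ cong (_+ ∑< n (f m)) (∑-comm f m n) ⟩
  ∑[ j < n ] ∑[ i < m ] f i j + ∑[ j < n ] f m j ≡⟨ sym (∑-distrib-+ n) ⟩
  ∑[ j < n ] ∑[ i < suc m ] f i j                 ∎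

∑-zero : ∀ {f : ℕ → ℕ} n → (∀ i → f i ≡ 0) → ∑< n f ≡ 0
∑-zero n eq = trans (∑-cong n eq) (trans (∑-const n 0) (*-zeroʳ n))

∑-stable : ∀ (f : ℕ → ℕ) {m n} → m ≤ n → (∀ i → m ≤ i → f i ≡ 0) → ∑< n f ≡ ∑< m f
∑-stable f {m} {n} m≤n vanish = begin
  ∑< n f                                ≡⟨ cong (λ l → ∑< l f) (sym (m+[n∸m]≡n m≤n)) ⟩
  ∑< (m + (n ∸ m)) f                    ≡⟨ ∑-+ f m (n ∸ m) ⟩
  ∑< m f + ∑[ i < n ∸ m ] f (m + i)     ≡⟨ cong (∑< m f +_) (∑-zero (n ∸ m) (λ i → vanish (m + i) (m≤m+n m i))) ⟩
  ∑< m f + 0                            ≡⟨ +-identityʳ _ ⟩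
  ∑< m f                                ∎

∑-odd : ∀ n → ∑[ t < n ] suc (2 * t) ≡ n * n
∑-odd zero    = refl
∑-odd (suc n) = trans (cong (_+ suc (2 * n)) (∑-odd n)) (square-suc n)
  where
  square-suc : ∀ n → n * n + suc (2 * n) ≡ suc n * suc n
  square-suc = ℕ-Solver.solve-∀

sum-map-upTo : ∀ (f : ℕ → ℕ) n → sum (map f (upTo n)) ≡ ∑< n f
sum-map-upTo f zero    = refl
sum-map-upTo f (suc n) = begin
  sum (map f (upTo (suc n)))           ≡⟨ cong (sum ∘ map f) (sym (upTo-∷ʳ n)) ⟩
  sum (map f (upTo n ∷ʳ n))            ≡⟨ cong sum (map-++ f (upTo n) [ n ]) ⟩
  sum (map f (upTo n) ++ [ f n ])      ≡⟨ sum-++ (map f (upTo n)) [ f n ] ⟩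
  sum (map f (upTo n)) + (f n + 0)     ≡⟨ cong₂ _+_ (sum-map-upTo f n) (+-identityʳ (f n)) ⟩
  ∑< n f + f n                         ∎

sum-map-oneTo : ∀ (f : ℕ → ℕ) n → sum (map f (oneTo n)) ≡ ∑[ i < n ] f (suc i)
sum-map-oneTo f n = trans (cong sum (sym (map-∘ (upTo n)))) (sum-map-upTo (f ∘ suc) n)

map-oneTo-suc : ∀ (f : ℕ → ℕ) k → map f (oneTo (suc k)) ≡ f 1 ∷ map (f ∘ suc) (oneTo k)
map-oneTo-suc f k = cong (f 1 ∷_) (begin
  map f (map suc (applyUpTo suc k))    ≡⟨ cong (map f ∘ map suc) (map-upTo suc k) ⟨
  map f (map suc (map suc (upTo k)))   ≡⟨ map-∘ (map suc (upTo k)) ⟨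
  map (f ∘ suc) (map suc (upTo k))     ∎)

𝟙< : ℕ → ℕ → ℕ
𝟙< t s = if does (t <? s) then 1 else 0

𝟙<-yes : ∀ {t s} → t < s → 𝟙< t s ≡ 1
𝟙<-yes {t} {s} t<s = cong (λ b → if b then 1 else 0) (dec-true (t <? s) t<s)

𝟙<-no : ∀ {t s} → s ≤ t → 𝟙< t s ≡ 0
𝟙<-no {t} {s} s≤t = cong (λ b → if b then 1 else 0) (dec-false (t <? s) (≤⇒≯ s≤t))

∑-𝟙< : ∀ (g : ℕ → ℕ) {s n} → s ≤ n → ∑[ t < n ] (g t * 𝟙< t s) ≡ ∑< s g
∑-𝟙< g {s} {n} s≤n = begin
  ∑[ t < n ] (g t * 𝟙< t s)
    ≡⟨ ∑-stable (λ t → g t * 𝟙< t s) s≤n (λ t s≤t → trans (cong (g t *_) (𝟙<-no s≤t)) (*-zeroʳ (g t))) ⟩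
  ∑[ t < s ] (g t * 𝟙< t s)
    ≡⟨ ∑-cong-< s (λ t t<s → trans (cong (g t *_) (𝟙<-yes t<s)) (*-identityʳ (g t))) ⟩
  ∑< s g
    ∎

∑-double-count : ∀ (g σ : ℕ → ℕ) k {n} → (∀ j → σ j ≤ n) →
  ∑[ t < n ] (g t * ∑[ j < k ] 𝟙< t (σ j)) ≡ ∑[ j < k ] ∑< (σ j) g
∑-double-count g σ k {n} σ≤n = begin
  ∑[ t < n ] (g t * ∑[ j < k ] 𝟙< t (σ j))    ≡⟨ ∑-cong n (λ t → sym (∑-distribˡ-* (g t) (λ j → 𝟙< t (σ j)) k)) ⟩
  ∑[ t < n ] ∑[ j < k ] (g t * 𝟙< t (σ j))    ≡⟨ ∑-comm (λ t j → g t * 𝟙< t (σ j)) n k ⟩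
  ∑[ j < k ] ∑[ t < n ] (g t * 𝟙< t (σ j))    ≡⟨ ∑-cong k (λ j → ∑-𝟙< g (σ≤n j)) ⟩
  ∑[ j < k ] ∑< (σ j) g                       ∎

∑-by-parts : ∀ (e σ : ℕ → ℕ) n →
  (∀ j → e j ≤ e (suc j)) → (∀ j → σ (suc (suc j)) ≤ σ (suc j)) → e 0 ≡ 0 →
  ∑[ j < n ] (e (suc j) * (σ (suc j) ∸ σ (suc (suc j)))) + e n * σ (suc n)
    ≡ ∑[ j < n ] ((e (suc j) ∸ e j) * σ (suc j))
∑-by-parts e σ zero    e↑ σ↓ e0≡0 = cong (_* σ 1) e0≡0
∑-by-parts e σ (suc n) e↑ σ↓ e0≡0 = begin
  S + e (suc n) * (σ (suc n) ∸ σ (suc (suc n))) + e (suc n) * σ (suc (suc n))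
    ≡⟨ +-assoc S _ _ ⟩
  S + (e (suc n) * (σ (suc n) ∸ σ (suc (suc n))) + e (suc n) * σ (suc (suc n)))
    ≡⟨ cong (S +_) (trans (sym (*-distribˡ-+ (e (suc n)) _ _)) (cong (e (suc n) *_) (m∸n+n≡m (σ↓ n)))) ⟩
  S + e (suc n) * σ (suc n)
    ≡⟨ cong (λ x → S + x * σ (suc n)) (m+[n∸m]≡n (e↑ n)) ⟨
  S + (e n + (e (suc n) ∸ e n)) * σ (suc n)
    ≡⟨ cong (S +_) (*-distribʳ-+ (σ (suc n)) (e n) _) ⟩
  S + (e n * σ (suc n) + (e (suc n) ∸ e n) * σ (suc n))
    ≡⟨ +-assoc S _ _ ⟨
  S + e n * σ (suc n) + (e (suc n) ∸ e n) * σ (suc n)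
    ≡⟨ cong (_+ (e (suc n) ∸ e n) * σ (suc n)) (∑-by-parts e σ n e↑ σ↓ e0≡0) ⟩
  ∑[ j < suc n ] ((e (suc j) ∸ e j) * σ (suc j))
    ∎
  where S = ∑[ j < n ] (e (suc j) * (σ (suc j) ∸ σ (suc (suc j))))

m≡n+o⇒m∸n≡o : ∀ {m n o} → m ≡ n + o → m ∸ n ≡ o
m≡n+o⇒m∸n≡o {n = n} {o} m≡n+o = trans (cong (_∸ n) m≡n+o) (m+n∸m≡n n o)

2*n≤n*n+1 : ∀ n → 2 * n ≤ n * n + 1
2*n≤n*n+1 zero    = z≤n
2*n≤n*n+1 (suc n) = subst (2 * suc n ≤_) (expand n) (m≤n+m (2 * suc n) (n * n))
  where
  expand : ∀ n → n * n + 2 * suc n ≡ suc n * suc n + 1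
  expand = ℕ-Solver.solve-∀

pos-rebalance : ∀ x {r y w z} → r + y ≡ w + z → ℤ.+ x ℤ.- ℤ.+ y ℤ.+ ℤ.+ z ≡ ℤ.+ (x + r) ℤ.- ℤ.+ w
pos-rebalance x {r} {y} {w} {z} r+y≡w+z = begin
  X ℤ.- Y ℤ.+ Z                                   ≡⟨ split X R Y W Z ⟩
  X ℤ.+ R ℤ.- W ℤ.+ ((W ℤ.+ Z) ℤ.- (R ℤ.+ Y))     ≡⟨ cong (λ u → X ℤ.+ R ℤ.- W ℤ.+ (u ℤ.- (R ℤ.+ Y))) w+z≡r+y ⟩
  X ℤ.+ R ℤ.- W ℤ.+ ((R ℤ.+ Y) ℤ.- (R ℤ.+ Y))     ≡⟨ cancel (X ℤ.+ R ℤ.- W) (R ℤ.+ Y) ⟩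
  X ℤ.+ R ℤ.- W                                   ≡⟨ cong (λ u → u ℤ.- W) (ℤP.pos-+ x r) ⟨
  ℤ.+ (x + r) ℤ.- W                               ∎
  where
  X = ℤ.+ x
  R = ℤ.+ r
  Y = ℤ.+ y
  W = ℤ.+ w
  Z = ℤ.+ z
  w+z≡r+y : W ℤ.+ Z ≡ R ℤ.+ Y
  w+z≡r+y = trans (sym (ℤP.pos-+ w z)) (trans (cong ℤ.+_ (sym r+y≡w+z)) (ℤP.pos-+ r y))
  split : ∀ X R Y W Z → X ℤ.- Y ℤ.+ Z ≡ X ℤ.+ R ℤ.- W ℤ.+ ((W ℤ.+ Z) ℤ.- (R ℤ.+ Y))
  split = ℤ-Solver.solve-∀
  cancel : ∀ A U → A ℤ.+ (U ℤ.- U) ≡ A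
  cancel = ℤ-Solver.solve-∀

pos-≤-rebalance : ∀ {p x y k} → p + y ≤ x + k → ℤ.+ p ℤ.≤ ℤ.+ x ℤ.- ℤ.+ y ℤ.+ ℤ.+ k
pos-≤-rebalance {p} {x} {y} {k} p+y≤x+k =
  subst₂ ℤ._≤_ (sym (cancel p y)) (shift x k y) (ℤP.+-monoˡ-≤ (ℤ.- ℤ.+ y) (ℤ.+≤+ p+y≤x+k))
  where
  cancel : ∀ p y → ℤ.+ p ≡ ℤ.+ (p + y) ℤ.- ℤ.+ y
  cancel p y = trans (add-sub (ℤ.+ p) (ℤ.+ y)) (cong (λ u → u ℤ.- ℤ.+ y) (sym (ℤP.pos-+ p y)))
    where
    add-sub : ∀ P Y → P ≡ P ℤ.+ Y ℤ.- Y
    add-sub = ℤ-Solver.solve-∀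
  shift : ∀ x k y → ℤ.+ (x + k) ℤ.- ℤ.+ y ≡ ℤ.+ x ℤ.- ℤ.+ y ℤ.+ ℤ.+ k
  shift x k y = trans (cong (λ u → u ℤ.- ℤ.+ y) (ℤP.pos-+ x k)) (swap (ℤ.+ x) (ℤ.+ k) (ℤ.+ y))
    where
    swap : ∀ X K Y → X ℤ.+ K ℤ.- Y ≡ X ℤ.- Y ℤ.+ K
    swap = ℤ-Solver.solve-∀

i≤+∣i∣ : ∀ i → i ℤ.≤ ℤ.+ ∣ i ∣
i≤+∣i∣ (ℤ.+ m)  = ℤP.≤-refl
i≤+∣i∣ -[1+ m ] = ℤ.-≤+

∣m∣n⇒∣m∸n : ∀ {d m n} → n ≤ m → d ∣ m → d ∣ n → d ∣ m ∸ n
∣m∣n⇒∣m∸n {d} n≤m d∣m d∣n = ∣m+n∣m⇒∣n (subst (d ∣_) (sym (m+[n∸m]≡n n≤m)) d∣m) d∣n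

2*n/2≡n : ∀ r → 2 * r / 2 ≡ r
2*n/2≡n r = trans (cong (_/ 2) (*-comm 2 r)) (m*n/n≡m r 2)

evenCeil : ℕ → ℕ
evenCeil n = ⌈ n /2⌉ * 2

evenCeil-even : ∀ n → 2 ∣ evenCeil n
evenCeil-even n = divides ⌈ n /2⌉ refl

n≤evenCeil : ∀ n → n ≤ evenCeil n
n≤evenCeil zero          = z≤n
n≤evenCeil (suc zero)    = s≤s z≤n
n≤evenCeil (suc (suc n)) = s≤s (s≤s (n≤evenCeil n))

evenCeil-least : ∀ n {x} → 2 ∣ x → n ≤ x → evenCeil n ≤ x
evenCeil-least zero          _     _               = z≤n
evenCeil-least (suc zero)    {suc zero} (divides (suc _) ()) _
evenCeil-least (suc zero)    {suc (suc x)} _ _      = s≤s (s≤s z≤n)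
evenCeil-least (suc (suc n)) {suc (suc x)} 2∣x+2 (s≤s (s≤s n≤x)) =
  s≤s (s≤s (evenCeil-least n (∣m+n∣m⇒∣n 2∣x+2 (divides 1 refl)) n≤x))

evenCeil-mono-≤ : ∀ {m n} → m ≤ n → evenCeil m ≤ evenCeil n
evenCeil-mono-≤ m≤n = *-monoˡ-≤ 2 (⌈n/2⌉-mono m≤n)

evenCeil-double : ∀ q → evenCeil (2 * q) ≡ 2 * q
evenCeil-double q = begin
  ⌈ q + (q + 0) /2⌉ * 2   ≡⟨ cong (λ n → ⌈ q + n /2⌉ * 2) (+-identityʳ q) ⟩
  ⌈ q + q /2⌉ * 2         ≡⟨ cong (_* 2) (n≡⌈n+n/2⌉ q) ⟨
  q * 2                   ≡⟨ *-comm q 2 ⟩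
  2 * q                   ∎

evenCeil-suc-double : ∀ q → evenCeil (suc (2 * q)) ≡ 2 + 2 * q
evenCeil-suc-double q = begin
  suc ⌊ q + (q + 0) /2⌋ * 2   ≡⟨ cong (λ n → suc ⌊ q + n /2⌋ * 2) (+-identityʳ q) ⟩
  suc ⌊ q + q /2⌋ * 2         ≡⟨ cong (λ n → suc n * 2) (n≡⌊n+n/2⌋ q) ⟨
  suc q * 2                   ≡⟨ *-comm (suc q) 2 ⟩
  2 * suc q                   ≡⟨ *-suc 2 q ⟩
  2 + 2 * q                   ∎

module _ {A B : Set} where

  sum-concatMap : ∀ (f : B → ℕ) (g : A → List B) xs →
    sum (map f (concatMap g xs)) ≡ sum (map (λ x → sum (map f (g x))) xs)
  sum-concatMap f g []       = refl
  sum-concatMap f g (x ∷ xs) = begin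
    sum (map f (g x ++ concatMap g xs))                ≡⟨ cong sum (map-++ f (g x) _) ⟩
    sum (map f (g x) ++ map f (concatMap g xs))        ≡⟨ sum-++ (map f (g x)) _ ⟩
    sum (map f (g x)) + sum (map f (concatMap g xs))   ≡⟨ cong (sum (map f (g x)) +_) (sum-concatMap f g xs) ⟩
    sum (map (λ x → sum (map f (g x))) (x ∷ xs))       ∎

  length-concatMap : ∀ (g : A → List B) xs → length (concatMap g xs) ≡ sum (map (length ∘ g) xs)
  length-concatMap g []       = refl
  length-concatMap g (x ∷ xs) = trans (length-++ (g x)) (cong (length (g x) +_) (length-concatMap g xs))

  ∈-concatMap⁻′ : ∀ (g : A → List B) {xs z} → z ∈ concatMap g xs → ∃ λ x → x ∈ xs × z ∈ g x
  ∈-concatMap⁻′ g z∈ = find (∈-concatMap⁻ g z∈)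

  ∈-concatMap⁺′ : ∀ (g : A → List B) {xs x z} → x ∈ xs → z ∈ g x → z ∈ concatMap g xs
  ∈-concatMap⁺′ g x∈ z∈ = ∈-concatMap⁺ g (lose x∈ z∈)

  unique-concatMap : ∀ (g : A → List B) {xs} → Unique xs → (∀ {x} → x ∈ xs → Unique (g x)) →
    (∀ {x y z} → x ∈ xs → y ∈ xs → z ∈ g x → z ∈ g y → x ≡ y) → Unique (concatMap g xs)
  unique-concatMap g {[]}     []         _       _        = []
  unique-concatMap g {x ∷ xs} (x∉ ∷ xs!) unique⟨g⟩ disjoint =
    Unique.++⁺ (unique⟨g⟩ (here refl))
               (unique-concatMap g xs! (unique⟨g⟩ ∘ there) (λ x∈ y∈ → disjoint (there x∈) (there y∈)))
               λ (z∈gx , z∈rest) → let y , y∈ , z∈gy = ∈-concatMap⁻′ g z∈rest in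
                 All.lookup x∉ y∈ (disjoint (here refl) (there y∈) z∈gx z∈gy)

  unique-map : ∀ (f : A → B) {xs} → (∀ {x y} → x ∈ xs → y ∈ xs → f x ≡ f y → x ≡ y) →
    Unique xs → Unique (map f xs)
  unique-map f {[]}     _   []         = []
  unique-map f {x ∷ xs} inj (x∉ ∷ xs!) =
    AllP.map⁺ (All.tabulate (λ y∈ fx≡fy → All.lookup x∉ y∈ (inj (here refl) (there y∈) fx≡fy)))
    ∷ unique-map f (λ x∈ y∈ → inj (there x∈) (there y∈)) xs!

sum-map-const : ∀ {A : Set} (xs : List A) c → sum (map (λ _ → c) xs) ≡ length xs * c
sum-map-const []       c = refl
sum-map-const (x ∷ xs) c = cong (c +_) (sum-map-const xs c)

sum-map-zero : ∀ {A : Set} {f : A → ℕ} xs → (∀ {x} → x ∈ xs → f x ≡ 0) → sum (map f xs) ≡ 0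
sum-map-zero xs vanish =
  trans (cong sum (map-cong-local (All.tabulate vanish))) (trans (sum-map-const xs 0) (*-zeroʳ (length xs)))

module _ {A : Set} where

  conses : List A → (A → List (List A)) → List (List A)
  conses xs tails = concatMap (λ x → map (x ∷_) (tails x)) xs

  ∈-conses⁻ : ∀ {xs tails z} → z ∈ conses xs tails → ∃₂ λ x ys → x ∈ xs × ys ∈ tails x × z ≡ x ∷ ys
  ∈-conses⁻ {xs} z∈ with ∈-concatMap⁻′ _ {xs} z∈
  ... | x , x∈ , z∈x∷ with ∈-map⁻ (x ∷_) z∈x∷
  ...   | ys , ys∈ , refl = x , ys , x∈ , ys∈ , refl

  ∈-conses⁺ : ∀ {xs tails x ys} → x ∈ xs → ys ∈ tails x → x ∷ ys ∈ conses xs tails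
  ∈-conses⁺ x∈ ys∈ = ∈-concatMap⁺′ _ x∈ (∈-map⁺ _ ys∈)

  unique-conses : ∀ {xs tails} → Unique xs → (∀ x → Unique (tails x)) → Unique (conses xs tails)
  unique-conses {xs} {tails} xs! tails! =
    unique-concatMap _ xs! (λ {x} _ → Unique.map⁺ ∷-injectiveʳ (tails! x)) same-head
    where
    same-head : ∀ {x y z} → x ∈ xs → y ∈ xs → z ∈ map (x ∷_) (tails x) → z ∈ map (y ∷_) (tails y) → x ≡ y
    same-head _ _ z∈x∷ z∈y∷ with ∈-map⁻ _ z∈x∷ | ∈-map⁻ _ z∈y∷
    ... | _ , _ , refl | _ , _ , refl = refl

  length-conses : ∀ xs (tails : A → List (List A)) → length (conses xs tails) ≡ sum (map (length ∘ tails) xs)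
  length-conses xs tails = trans (length-concatMap _ xs)
    (cong sum (map-cong-local {xs = xs} (All.tabulate (λ {x} _ → length-map (x ∷_) (tails x)))))

length-filter : ∀ {A : Set} {P : A → Set} (P? : Decidable P) xs →
  length (filter P? xs) ≡ sum (map (λ x → if does (P? x) then 1 else 0) xs)
length-filter P? []       = refl
length-filter P? (x ∷ xs) with does (P? x)
... | true  = cong suc (length-filter P? xs)
... | false = length-filter P? xs

-- Graded classes with explicit enumerations

record GradedClass (B : Set) : Set₁ where
  field
    Valid         : B → Set
    grade         : B → ℕ
    series        : Series
    enum          : ℕ → List B
    enum-unique   : ∀ n → Unique (enum n)
    enum-sound    : ∀ {n x} → x ∈ enum n → Valid x × grade x ≡ n
    enum-complete : ∀ {x} → Valid x → x ∈ enum (grade x)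
    length-enum   : ∀ n → length (enum n) ≡ series n

open GradedClass

module Geometric (j : ℕ) .{{_ : NonZero j}} where

  quotients : ∀ {n} → Dec (j ∣ n) → List ℕ
  quotients (yes (divides q _)) = [ q ]
  quotients (no _)              = []

  quotients-unique : ∀ {n} (j∣?n : Dec (j ∣ n)) → Unique (quotients j∣?n)
  quotients-unique (yes _) = [] ∷ []
  quotients-unique (no _)  = []

  quotients-sound : ∀ {n x} (j∣?n : Dec (j ∣ n)) → x ∈ quotients j∣?n → j * x ≡ n
  quotients-sound (yes (divides q n≡q*j)) (here refl) = trans (*-comm j q) (sym n≡q*j)

  quotients-complete : ∀ x (j∣?jx : Dec (j ∣ j * x)) → x ∈ quotients j∣?jx
  quotients-complete x (yes (divides q jx≡q*j)) = here (*-cancelʳ-≡ x q j (trans (*-comm x j) jx≡q*j))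
  quotients-complete x (no j∤jx)                = ⊥-elim (j∤jx (divides x (*-comm j x)))

  length-quotients : ∀ {n} (j∣?n : Dec (j ∣ n)) → length (quotients j∣?n) ≡ (if does j∣?n then 1 else 0)
  length-quotients (yes _) = refl
  length-quotients (no _)  = refl

geometric : (j : ℕ) .{{_ : NonZero j}} → GradedClass ℕ
geometric j = record
  { Valid         = λ _ → ⊤
  ; grade         = j *_
  ; series        = geomS j
  ; enum          = λ n → quotients (j ∣? n)
  ; enum-unique   = λ n → quotients-unique (j ∣? n)
  ; enum-sound    = λ {n} x∈ → tt , quotients-sound (j ∣? n) x∈
  ; enum-complete = λ {x} _ → quotients-complete x (j ∣? (j * x))
  ; length-enum   = λ n → length-quotients (j ∣? n)
  }
  where open Geometric j

module Product {I B : Set} (C : I → GradedClass B) where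

  ValidP : List I → List B → Set
  ValidP = Pointwise (λ i → Valid (C i))

  gradeP : List I → List B → ℕ
  gradeP (i ∷ is) (x ∷ xs) = grade (C i) x + gradeP is xs
  gradeP _        _        = 0

  seriesP : List I → Series
  seriesP is = foldr _⊛_ oneS (map (λ i → series (C i)) is)

  heads : I → ℕ → List B
  heads i n = concatMap (enum (C i)) (upTo (suc n))

  enumP : List I → ℕ → List (List B)
  enumP []       zero    = [ [] ]
  enumP []       (suc _) = []
  enumP (i ∷ is) n       = conses (heads i n) (λ x → enumP is (n ∸ grade (C i) x))

  ∈-heads⁻ : ∀ {i n x} → x ∈ heads i n → Valid (C i) x × grade (C i) x ≤ n
  ∈-heads⁻ {i} {n} x∈ with ∈-concatMap⁻′ (enum (C i)) {upTo (suc n)} x∈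
  ... | m , m∈ , x∈enum with enum-sound (C i) x∈enum
  ...   | valid , refl = valid , ℕ.s≤s⁻¹ (∈-upTo⁻ m∈)

  ∈-heads⁺ : ∀ {i x} n → Valid (C i) x → grade (C i) x ≤ n → x ∈ heads i n
  ∈-heads⁺ {i} n valid x≤n = ∈-concatMap⁺′ (enum (C i)) (∈-upTo⁺ (s≤s x≤n)) (enum-complete (C i) valid)

  heads-unique : ∀ i n → Unique (heads i n)
  heads-unique i n = unique-concatMap (enum (C i)) (Unique.upTo⁺ (suc n)) (λ {m} _ → enum-unique (C i) m) same-grade
    where
    same-grade : ∀ {m m′ x} → m ∈ upTo (suc n) → m′ ∈ upTo (suc n) → x ∈ enum (C i) m → x ∈ enum (C i) m′ → m ≡ m′
    same-grade _ _ x∈m x∈m′ = trans (sym (proj₂ (enum-sound (C i) x∈m))) (proj₂ (enum-sound (C i) x∈m′))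

  enumP-unique : ∀ is n → Unique (enumP is n)
  enumP-unique []       zero    = [] ∷ []
  enumP-unique []       (suc n) = []
  enumP-unique (i ∷ is) n       = unique-conses (heads-unique i n) (λ x → enumP-unique is (n ∸ grade (C i) x))

  enumP-sound : ∀ is {n xs} → xs ∈ enumP is n → ValidP is xs × gradeP is xs ≡ n
  enumP-sound []       {zero} (here refl) = [] , refl
  enumP-sound (i ∷ is) {n}    xs∈ with ∈-conses⁻ {xs = heads i n} xs∈
  ... | x , ys , x∈ , ys∈ , refl with ∈-heads⁻ x∈ | enumP-sound is ys∈
  ...   | valid , x≤n | valids , grade⟨ys⟩ =
    valid ∷ valids , trans (cong (grade (C i) x +_) grade⟨ys⟩) (m+[n∸m]≡n x≤n)

  enumP-complete : ∀ is {xs} → ValidP is xs → xs ∈ enumP is (gradeP is xs)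
  enumP-complete []       []                           = here refl
  enumP-complete (i ∷ is) {x ∷ xs} (valid ∷ valids) =
    ∈-conses⁺ (∈-heads⁺ _ valid (m≤m+n _ _))
              (subst (λ n → xs ∈ enumP is n) (sym (m+n∸m≡n (grade (C i) x) _)) (enumP-complete is valids))

  length-enumP : ∀ is n → length (enumP is n) ≡ seriesP is n
  length-enumP []       zero    = refl
  length-enumP []       (suc n) = refl
  length-enumP (i ∷ is) n       = begin
    length (enumP (i ∷ is) n)
      ≡⟨ length-conses (heads i n) _ ⟩
    sum (map (λ x → length (enumP is (n ∸ grade (C i) x))) (heads i n))
      ≡⟨ sum-concatMap _ (enum (C i)) (upTo (suc n)) ⟩
    sum (map (λ m → sum (map (λ x → length (enumP is (n ∸ grade (C i) x))) (enum (C i) m))) (upTo (suc n)))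
      ≡⟨ cong sum (map-cong-local {xs = upTo (suc n)} (All.tabulate (λ {m} _ → count m))) ⟩
    sum (map (λ m → series (C i) m * seriesP is (n ∸ m)) (upTo (suc n)))
      ∎
    where
    count : ∀ m → sum (map (λ x → length (enumP is (n ∸ grade (C i) x))) (enum (C i) m))
                    ≡ series (C i) m * seriesP is (n ∸ m)
    count m = begin
      sum (map (λ x → length (enumP is (n ∸ grade (C i) x))) (enum (C i) m))
        ≡⟨ cong sum (map-cong-local (All.tabulate length-tail)) ⟩
      sum (map (λ _ → seriesP is (n ∸ m)) (enum (C i) m))
        ≡⟨ sum-map-const (enum (C i) m) _ ⟩
      length (enum (C i) m) * seriesP is (n ∸ m)
        ≡⟨ cong (_* seriesP is (n ∸ m)) (length-enum (C i) m) ⟩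
      series (C i) m * seriesP is (n ∸ m)
        ∎
      where
      length-tail : ∀ {x} → x ∈ enum (C i) m → length (enumP is (n ∸ grade (C i) x)) ≡ seriesP is (n ∸ m)
      length-tail x∈ =
        trans (cong (λ g → length (enumP is (n ∸ g))) (proj₂ (enum-sound (C i) x∈))) (length-enumP is (n ∸ m))

product : ∀ {I B : Set} → (I → GradedClass B) → List I → GradedClass (List B)
product C is = record
  { Valid         = ValidP is
  ; grade         = gradeP is
  ; series        = seriesP is
  ; enum          = enumP is
  ; enum-unique   = enumP-unique is
  ; enum-sound    = enumP-sound is
  ; enum-complete = enumP-complete is
  ; length-enum   = length-enumP is
  }
  where open Product C

invPoch2Class : ℕ → GradedClass (List ℕ)
invPoch2Class d = product (λ t → geometric (2 * suc t)) (upTo d)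

termClass : List ℕ → GradedClass (List (List ℕ))
termClass ds = product invPoch2Class ds

length⇒Pointwise-⊤ : ∀ {A B : Set} {xs : List A} {ys : List B} → length xs ≡ length ys →
  Pointwise (λ _ _ → ⊤) xs ys
length⇒Pointwise-⊤ {xs = []}     {[]}     _   = []
length⇒Pointwise-⊤ {xs = x ∷ xs} {y ∷ ys} len = tt ∷ length⇒Pointwise-⊤ (suc-injective len)

valid-termClass⇔ : ∀ ds rss → Valid (termClass ds) rss ⇔ map length rss ≡ ds
valid-termClass⇔ ds rss = mk⇔ (to ds rss) (from ds rss)
  where
  to : ∀ ds rss → Valid (termClass ds) rss → map length rss ≡ ds
  to []       []         []               = refl
  to (d ∷ ds) (rs ∷ rss) (valid ∷ valids) =
    cong₂ _∷_ (trans (sym (Pointwise-length valid)) (length-upTo d)) (to ds rss valids)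
  from : ∀ ds rss → map length rss ≡ ds → Valid (termClass ds) rss
  from []       []         _   = []
  from (d ∷ ds) (rs ∷ rss) eq with ∷-injective eq
  ... | refl , lengths = length⇒Pointwise-⊤ (length-upTo (length rs)) ∷ from ds rss lengths

-- Partitions into even parts and their gaps

EvenAtLeast : ℕ → ℕ → Set
EvenAtLeast e x = 2 ∣ x × e ≤ x

-- For even e, a partition into ℓ even parts ≥ e is determined by its ℓ halved gaps (the last
-- one measured from e), and every list of ℓ gaps arises.
fromGaps : ℕ → List ℕ → List ℕ
fromGaps e []       = []
fromGaps e (r ∷ rs) = e + 2 * sum (r ∷ rs) ∷ fromGaps e rs

gaps : ℕ → List ℕ → List ℕ
gaps e []           = []
gaps e (x ∷ [])     = (x ∸ e) / 2 ∷ []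
gaps e (x ∷ y ∷ xs) = (x ∸ y) / 2 ∷ gaps e (y ∷ xs)

length-fromGaps : ∀ e rs → length (fromGaps e rs) ≡ length rs
length-fromGaps e []       = refl
length-fromGaps e (r ∷ rs) = cong suc (length-fromGaps e rs)

length-gaps : ∀ e p → length (gaps e p) ≡ length p
length-gaps e []           = refl
length-gaps e (x ∷ [])     = refl
length-gaps e (x ∷ y ∷ xs) = cong suc (length-gaps e (y ∷ xs))

gaps-fromGaps : ∀ e rs → gaps e (fromGaps e rs) ≡ rs
gaps-fromGaps e []            = refl
gaps-fromGaps e (r ∷ [])      = cong (_∷ []) (begin
  (e + 2 * (r + 0) ∸ e) / 2   ≡⟨ cong (_/ 2) (m+n∸m≡n e _) ⟩
  2 * (r + 0) / 2             ≡⟨ 2*n/2≡n (r + 0) ⟩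
  r + 0                       ≡⟨ +-identityʳ r ⟩
  r                           ∎)
gaps-fromGaps e (r ∷ r′ ∷ rs) = cong₂ _∷_ (begin
  (e + 2 * (r + S) ∸ (e + 2 * S)) / 2 ≡⟨ cong (_/ 2) ([m+n]∸[m+o]≡n∸o e (2 * (r + S)) (2 * S)) ⟩
  (2 * (r + S) ∸ 2 * S) / 2           ≡⟨ cong (λ x → (x ∸ 2 * S) / 2) (*-distribˡ-+ 2 r S) ⟩
  (2 * r + 2 * S ∸ 2 * S) / 2         ≡⟨ cong (_/ 2) (m+n∸n≡m (2 * r) (2 * S)) ⟩
  2 * r / 2                           ≡⟨ 2*n/2≡n r ⟩
  r                                   ∎) (gaps-fromGaps e (r′ ∷ rs))
  where S = sum (r′ ∷ rs)

fromGaps-head : ∀ e rs {y ys} → fromGaps e rs ≡ y ∷ ys → e + 2 * sum rs ≡ y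
fromGaps-head e (r ∷ rs) eq = proj₁ (∷-injective eq)

fromGaps-gaps : ∀ e → 2 ∣ e → ∀ p → IsPartition p → All (EvenAtLeast e) p → fromGaps e (gaps e p) ≡ p
fromGaps-gaps e 2∣e []           _ _ = refl
fromGaps-gaps e 2∣e (x ∷ [])     _ ((2∣x , e≤x) ∷ []) = cong (_∷ []) (begin
  e + 2 * ((x ∸ e) / 2 + 0) ≡⟨ cong (λ h → e + 2 * h) (+-identityʳ ((x ∸ e) / 2)) ⟩
  e + 2 * ((x ∸ e) / 2)     ≡⟨ cong (e +_) (m*[n/m]≡n (∣m∣n⇒∣m∸n e≤x 2∣x 2∣e)) ⟩
  e + (x ∸ e)               ≡⟨ m+[n∸m]≡n e≤x ⟩
  x                         ∎)
fromGaps-gaps e 2∣e (x ∷ y ∷ xs) (y≤x ∷ y∷xs-partition) ((2∣x , _) ∷ y∷xs-even@((2∣y , _) ∷ _)) =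
  cong₂ _∷_ head rest
  where
  G = gaps e (y ∷ xs)
  rest : fromGaps e G ≡ y ∷ xs
  rest = fromGaps-gaps e 2∣e (y ∷ xs) y∷xs-partition y∷xs-even
  head : e + 2 * ((x ∸ y) / 2 + sum G) ≡ x
  head = begin
    e + 2 * ((x ∸ y) / 2 + sum G)           ≡⟨ rearrange e ((x ∸ y) / 2) (sum G) ⟩
    2 * ((x ∸ y) / 2) + (e + 2 * sum G)     ≡⟨ cong₂ _+_ (m*[n/m]≡n (∣m∣n⇒∣m∸n y≤x 2∣x 2∣y))
                                                           (fromGaps-head e G rest) ⟩
    (x ∸ y) + y                             ≡⟨ m∸n+n≡m y≤x ⟩
    x                                       ∎
    where
    rearrange : ∀ e h s → e + 2 * (h + s) ≡ 2 * h + (e + 2 * s)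
    rearrange = ℕ-Solver.solve-∀

fromGaps-partition : ∀ e rs → IsPartition (fromGaps e rs)
fromGaps-partition e []            = []
fromGaps-partition e (r ∷ [])      = [-]
fromGaps-partition e (r ∷ r′ ∷ rs) =
  +-monoʳ-≤ e (*-monoʳ-≤ 2 (m≤n+m (sum (r′ ∷ rs)) r)) ∷ fromGaps-partition e (r′ ∷ rs)

fromGaps-evenAtLeast : ∀ e → 2 ∣ e → ∀ rs → All (EvenAtLeast e) (fromGaps e rs)
fromGaps-evenAtLeast e 2∣e []       = []
fromGaps-evenAtLeast e 2∣e (r ∷ rs) =
  (∣m∣n⇒∣m+n 2∣e (m∣m*n (sum (r ∷ rs))) , m≤m+n e _) ∷ fromGaps-evenAtLeast e 2∣e rs

module GeometricProduct = Product (λ t → geometric (2 * suc t))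

gradeP-map-suc : ∀ ts rs → length ts ≡ length rs →
  GeometricProduct.gradeP (map suc ts) rs ≡ GeometricProduct.gradeP ts rs + 2 * sum rs
gradeP-map-suc []       []       _   = refl
gradeP-map-suc (t ∷ ts) (r ∷ rs) len = begin
  2 * suc (suc t) * r + G (map suc ts) rs
    ≡⟨ cong (2 * suc (suc t) * r +_) (gradeP-map-suc ts rs (suc-injective len)) ⟩
  2 * suc (suc t) * r + (G ts rs + 2 * sum rs)
    ≡⟨ rearrange t r (G ts rs) (sum rs) ⟩
  2 * suc t * r + G ts rs + 2 * (r + sum rs)
    ∎
  where
  G = GeometricProduct.gradeP
  rearrange : ∀ t r g s → 2 * suc (suc t) * r + (g + 2 * s) ≡ 2 * suc t * r + g + 2 * (r + s)
  rearrange = ℕ-Solver.solve-∀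

sum-fromGaps : ∀ e rs → sum (fromGaps e rs) ≡ e * length rs + grade (invPoch2Class (length rs)) rs
sum-fromGaps e []       = sym (trans (+-identityʳ (e * 0)) (*-zeroʳ e))
sum-fromGaps e (r ∷ rs) = begin
  e + 2 * (r + sum rs) + sum (fromGaps e rs)
    ≡⟨ cong (e + 2 * (r + sum rs) +_) (sum-fromGaps e rs) ⟩
  e + 2 * (r + sum rs) + (e * ℓ + G (upTo ℓ) rs)
    ≡⟨ rearrange e r (sum rs) ℓ (G (upTo ℓ) rs) ⟩
  e * suc ℓ + (2 * 1 * r + (G (upTo ℓ) rs + 2 * sum rs))
    ≡⟨ cong (λ g → e * suc ℓ + (2 * 1 * r + g)) (gradeP-map-suc (upTo ℓ) rs (length-upTo ℓ)) ⟨
  e * suc ℓ + (2 * 1 * r + G (map suc (upTo ℓ)) rs)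
    ≡⟨ cong (λ ts → e * suc ℓ + G (0 ∷ ts) (r ∷ rs)) (map-upTo suc ℓ) ⟩
  e * suc ℓ + G (upTo (suc ℓ)) (r ∷ rs)
    ∎
  where
  ℓ = length rs
  G = GeometricProduct.gradeP
  rearrange : ∀ e r s ℓ g → e + 2 * (r + s) + (e * ℓ + g) ≡ e * suc ℓ + (2 * 1 * r + (g + 2 * s))
  rearrange = ℕ-Solver.solve-∀

EvenPartsAbove : (ℕ → ℕ) → (k : ℕ) → Tuple k → Set
EvenPartsAbove β k λs = (i : Fin k) →
  let p = V.lookup λs i ; m = suc (toℕ i) in
  IsPartition p × All (λ x → (2 ∣ x) × (β m ≤ x)) p

partLengths : ∀ {k} → Tuple k → List ℕ
partLengths λs = map length (V.toList λs)

-- Missing gap lists count as empty and surplus ones are ignored.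
tupleFromGaps : (ℕ → ℕ) → (k : ℕ) → List (List ℕ) → Tuple k
tupleFromGaps β zero    _          = V.[]
tupleFromGaps β (suc k) []         = [] V.∷ tupleFromGaps (β ∘ suc) k []
tupleFromGaps β (suc k) (rs ∷ rss) = fromGaps (evenCeil (β 1)) rs V.∷ tupleFromGaps (β ∘ suc) k rss

tupleGaps : (ℕ → ℕ) → ∀ {k} → Tuple k → List (List ℕ)
tupleGaps β V.[]       = []
tupleGaps β (p V.∷ λs) = gaps (evenCeil (β 1)) p ∷ tupleGaps (β ∘ suc) λs

tupleFromGaps-evenPartsAbove : ∀ β k rss → EvenPartsAbove β k (tupleFromGaps β k rss)
tupleFromGaps-evenPartsAbove β (suc k) []         fzero    = [] , []
tupleFromGaps-evenPartsAbove β (suc k) (rs ∷ rss) fzero    =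
  fromGaps-partition e rs , All.map (λ (2∣x , e≤x) → 2∣x , ≤-trans (n≤evenCeil (β 1)) e≤x)
                                    (fromGaps-evenAtLeast e (evenCeil-even (β 1)) rs)
  where e = evenCeil (β 1)
tupleFromGaps-evenPartsAbove β (suc k) []         (fsuc i) = tupleFromGaps-evenPartsAbove (β ∘ suc) k [] i
tupleFromGaps-evenPartsAbove β (suc k) (rs ∷ rss) (fsuc i) = tupleFromGaps-evenPartsAbove (β ∘ suc) k rss i

tupleFromGaps-tupleGaps : ∀ β k (λs : Tuple k) → EvenPartsAbove β k λs →
  tupleFromGaps β k (tupleGaps β λs) ≡ λs
tupleFromGaps-tupleGaps β zero    V.[]       _       = refl
tupleFromGaps-tupleGaps β (suc k) (p V.∷ λs) bounded = cong₂ V._∷_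
  (fromGaps-gaps (evenCeil (β 1)) (evenCeil-even (β 1)) p partition
    (All.map (λ (2∣x , β≤x) → 2∣x , evenCeil-least (β 1) 2∣x β≤x) parts))
  (tupleFromGaps-tupleGaps (β ∘ suc) k λs (bounded ∘ fsuc))
  where
  partition = proj₁ (bounded fzero)
  parts     = proj₂ (bounded fzero)

tupleGaps-tupleFromGaps : ∀ β k rss → length rss ≡ k → tupleGaps β (tupleFromGaps β k rss) ≡ rss
tupleGaps-tupleFromGaps β zero    []         _   = refl
tupleGaps-tupleFromGaps β (suc k) (rs ∷ rss) len =
  cong₂ _∷_ (gaps-fromGaps _ rs) (tupleGaps-tupleFromGaps (β ∘ suc) k rss (suc-injective len))

partLengths-tupleFromGaps : ∀ β k rss → length rss ≡ k → partLengths (tupleFromGaps β k rss) ≡ map length rss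
partLengths-tupleFromGaps β zero    []         _   = refl
partLengths-tupleFromGaps β (suc k) (rs ∷ rss) len =
  cong₂ _∷_ (length-fromGaps _ rs) (partLengths-tupleFromGaps (β ∘ suc) k rss (suc-injective len))

lengths-tupleGaps : ∀ β {k} (λs : Tuple k) → map length (tupleGaps β λs) ≡ partLengths λs
lengths-tupleGaps β V.[]       = refl
lengths-tupleGaps β (p V.∷ λs) = cong₂ _∷_ (length-gaps _ p) (lengths-tupleGaps (β ∘ suc) λs)

weightedSum : (ℕ → ℕ) → List ℕ → ℕ
weightedSum w []       = 0
weightedSum w (l ∷ ls) = w 1 * l + weightedSum (w ∘ suc) ls

sum-sizes-tupleFromGaps : ∀ β k rss → length rss ≡ k →
  sum (map size (V.toList (tupleFromGaps β k rss)))
    ≡ weightedSum (evenCeil ∘ β) (map length rss) + grade (termClass (map length rss)) rss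
sum-sizes-tupleFromGaps β zero    []         _   = refl
sum-sizes-tupleFromGaps β (suc k) (rs ∷ rss) len = begin
  sum (fromGaps e rs) + sum (map size (V.toList (tupleFromGaps (β ∘ suc) k rss)))
    ≡⟨ cong₂ _+_ (sum-fromGaps e rs) (sum-sizes-tupleFromGaps (β ∘ suc) k rss (suc-injective len)) ⟩
  e * length rs + g + (weightedSum (evenCeil ∘ β ∘ suc) (map length rss) + h)
    ≡⟨ +-interchange (e * length rs) g (weightedSum (evenCeil ∘ β ∘ suc) (map length rss)) h ⟩
  e * length rs + weightedSum (evenCeil ∘ β ∘ suc) (map length rss) + (g + h)
    ∎
  where
  e = evenCeil (β 1)
  g = grade (invPoch2Class (length rs)) rs
  h = grade (termClass (map length rss)) rss

weightedSum-oneTo : ∀ (w f : ℕ → ℕ) k → weightedSum w (map f (oneTo k)) ≡ ∑[ j < k ] (w (suc j) * f (suc j))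
weightedSum-oneTo w f zero    = refl
weightedSum-oneTo w f (suc k) = begin
  weightedSum w (map f (oneTo (suc k)))                   ≡⟨ cong (weightedSum w) (map-oneTo-suc f k) ⟩
  w 1 * f 1 + weightedSum (w ∘ suc) (map (f ∘ suc) (oneTo k))
    ≡⟨ cong (w 1 * f 1 +_) (weightedSum-oneTo (w ∘ suc) (f ∘ suc) k) ⟩
  w 1 * f 1 + ∑[ j < k ] (w (suc (suc j)) * f (suc (suc j)))
    ≡⟨ ∑-suc (λ j → w (suc j) * f (suc j)) k ⟨
  ∑[ j < suc k ] (w (suc j) * f (suc j))                  ∎

weightedSum-≥ : ∀ {c} (w : ℕ → ℕ) → (∀ m → c ≤ w (suc m)) → ∀ ls → c * sum ls ≤ weightedSum w ls
weightedSum-≥ {c} w c≤w []       = ≤-reflexive (*-zeroʳ c)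
weightedSum-≥ {c} w c≤w (l ∷ ls) = ≤-trans (≤-reflexive (*-distribˡ-+ c l (sum ls)))
  (+-mono-≤ (*-monoˡ-≤ l (c≤w 0)) (weightedSum-≥ (w ∘ suc) (c≤w ∘ suc) ls))

-- Chains, suffix sums and the frame sequence

Chain : ℕ → ℕ → List ℕ → Set
Chain zero    M []      = ⊤
Chain zero    M (_ ∷ _) = ⊥
Chain (suc k) M []      = ⊥
Chain (suc k) M (x ∷ s) = x ≤ M × Chain k x s

chains-sound : ∀ k M {s} → s ∈ chains k M → Chain k M s
chains-sound zero    M (here refl) = tt
chains-sound (suc k) M s∈ with ∈-conses⁻ {xs = upTo (suc M)} s∈
... | x , s′ , x∈ , s′∈ , refl = ℕ.s≤s⁻¹ (∈-upTo⁻ x∈) , chains-sound k x s′∈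

chains-complete : ∀ k M {s} → Chain k M s → s ∈ chains k M
chains-complete zero    M {[]}    _           = here refl
chains-complete (suc k) M {x ∷ s} (x≤M , ch) = ∈-conses⁺ (∈-upTo⁺ (s≤s x≤M)) (chains-complete k x ch)

chains-unique : ∀ k M → Unique (chains k M)
chains-unique zero    M = [] ∷ []
chains-unique (suc k) M = unique-conses (Unique.upTo⁺ (suc M)) (chains-unique k)

Chain-head : ∀ k {M s} → Chain k M s → at s 1 ≤ M
Chain-head zero    {s = []}    _         = z≤n
Chain-head (suc k) {s = x ∷ s} (x≤M , _) = x≤M

Chain-weaken : ∀ k {M N s} → Chain k M s → at s 1 ≤ N → Chain k N s
Chain-weaken zero    {s = []}    _        _   = tt
Chain-weaken (suc k) {s = x ∷ s} (_ , ch) x≤N = x≤N , ch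

at-antitone : ∀ k {M s} → Chain k M s → ∀ j → at s (suc (suc j)) ≤ at s (suc j)
at-antitone zero    {s = []}    _        j       = z≤n
at-antitone (suc k) {s = x ∷ s} (_ , ch) zero    = Chain-head k ch
at-antitone (suc k) {s = x ∷ s} (_ , ch) (suc j) = at-antitone k ch j

at-beyond : ∀ k {M s} → Chain k M s → ∀ j → k ≤ j → at s (suc j) ≡ 0
at-beyond zero    {s = []}    _        j             _         = refl
at-beyond (suc k) {s = x ∷ s} (_ , ch) (suc zero)    (s≤s z≤n) = at-beyond k ch zero z≤n
at-beyond (suc k) {s = x ∷ s} (_ , ch) (suc (suc j)) (s≤s k≤j) = at-beyond k ch (suc j) k≤j

sum-chains-stable : ∀ k (F : List ℕ → ℕ) {M N} → N ≤ M →
  (∀ {L s} → Chain k L s → N < at s 1 → F s ≡ 0) → sum (map F (chains k M)) ≡ sum (map F (chains k N))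
sum-chains-stable zero    F N≤M vanish = refl
sum-chains-stable (suc k) F {M} {N} N≤M vanish = begin
  sum (map F (chains (suc k) M)) ≡⟨ sum-conses M ⟩
  ∑< (suc M) H                   ≡⟨ ∑-stable H (s≤s N≤M) H-vanish ⟩
  ∑< (suc N) H                   ≡⟨ sum-conses N ⟨
  sum (map F (chains (suc k) N)) ∎
  where
  H : ℕ → ℕ
  H x = sum (map F (map (x ∷_) (chains k x)))
  sum-conses : ∀ L → sum (map F (chains (suc k) L)) ≡ ∑< (suc L) H
  sum-conses L =
    trans (sum-concatMap F (λ x → map (x ∷_) (chains k x)) (upTo (suc L))) (sum-map-upTo H (suc L))
  H-vanish : ∀ x → suc N ≤ x → H x ≡ 0
  H-vanish x N<x = sum-map-zero (map (x ∷_) (chains k x)) F-vanish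
    where
    F-vanish : ∀ {z} → z ∈ map (x ∷_) (chains k x) → F z ≡ 0
    F-vanish z∈ with ∈-map⁻ (x ∷_) z∈
    ... | s , s∈ , refl = vanish (≤-refl , chains-sound k x s∈) N<x

suffixSums : List ℕ → List ℕ
suffixSums []       = []
suffixSums (x ∷ xs) = x + sum xs ∷ suffixSums xs

at-suffixSums-1 : ∀ ls → at (suffixSums ls) 1 ≡ sum ls
at-suffixSums-1 []       = refl
at-suffixSums-1 (x ∷ xs) = refl

sum-drop : ∀ ls j → sum (drop j ls) ≡ at (suffixSums ls) (suc j)
sum-drop []           zero    = refl
sum-drop []           (suc j) = refl
sum-drop (x ∷ xs)     zero    = refl
sum-drop (x ∷ [])     (suc j) = sum-drop [] j
sum-drop (x ∷ y ∷ xs) (suc j) = sum-drop (y ∷ xs) j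

sum-drop-≤ : ∀ ls j → sum (drop j ls) ≤ sum ls
sum-drop-≤ []       zero    = ≤-refl
sum-drop-≤ []       (suc j) = ≤-refl
sum-drop-≤ (x ∷ xs) zero    = ≤-refl
sum-drop-≤ (x ∷ xs) (suc j) = ≤-trans (sum-drop-≤ xs j) (m≤n+m (sum xs) x)

suffixSums-chain : ∀ ls {M} → sum ls ≤ M → Chain (length ls) M (suffixSums ls)
suffixSums-chain []       _    = tt
suffixSums-chain (x ∷ xs) x+s≤M = x+s≤M , suffixSums-chain xs (m≤n+m (sum xs) x)

length-diffs : ∀ k s → length (diffs k s) ≡ k
length-diffs k s = trans (length-map _ (oneTo k)) (trans (length-map suc (upTo k)) (length-upTo k))

lengths≡diffs⇒length≡ : ∀ k s {rss : List (List ℕ)} → map length rss ≡ diffs k s → length rss ≡ k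
lengths≡diffs⇒length≡ k s {rss} lengths =
  trans (sym (length-map length rss)) (trans (cong length lengths) (length-diffs k s))

diffs-cons : ∀ k x s → diffs (suc k) (x ∷ s) ≡ x ∸ at s 1 ∷ diffs k s
diffs-cons k x s = trans (map-oneTo-suc _ k) (cong (x ∸ at s 1 ∷_) (begin
  map (λ j → at (x ∷ s) (suc j) ∸ at (x ∷ s) (suc (suc j))) (map suc (upTo k)) ≡⟨ map-∘ (upTo k) ⟨
  map (λ j → at s (suc j) ∸ at s (suc (suc j))) (upTo k)                       ≡⟨ map-∘ (upTo k) ⟩
  map (λ j → at s j ∸ at s (suc j)) (map suc (upTo k)) ∎))

diffs-suffixSums : ∀ ls → diffs (length ls) (suffixSums ls) ≡ ls
diffs-suffixSums []       = refl
diffs-suffixSums (x ∷ xs) = begin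
  diffs (suc (length xs)) (x + sum xs ∷ suffixSums xs)                       ≡⟨ diffs-cons (length xs) _ _ ⟩
  x + sum xs ∸ at (suffixSums xs) 1 ∷ diffs (length xs) (suffixSums xs)      ≡⟨ cong₂ _∷_ head (diffs-suffixSums xs) ⟩
  x ∷ xs                                                                     ∎
  where
  head : x + sum xs ∸ at (suffixSums xs) 1 ≡ x
  head = trans (cong (x + sum xs ∸_) (at-suffixSums-1 xs)) (m+n∸n≡m x (sum xs))

suffixSums-diffs : ∀ k {M s} → Chain k M s → suffixSums (diffs k s) ≡ s
suffixSums-diffs zero    {s = []}    _        = refl
suffixSums-diffs (suc k) {s = x ∷ s} (_ , ch) = begin
  suffixSums (diffs (suc k) (x ∷ s))                        ≡⟨ cong suffixSums (diffs-cons k x s) ⟩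
  x ∸ at s 1 + sum (diffs k s) ∷ suffixSums (diffs k s)     ≡⟨ cong₂ _∷_ head tail ⟩
  x ∷ s                                                     ∎
  where
  tail : suffixSums (diffs k s) ≡ s
  tail = suffixSums-diffs k ch
  head : x ∸ at s 1 + sum (diffs k s) ≡ x
  head = begin
    x ∸ at s 1 + sum (diffs k s)                  ≡⟨ cong (x ∸ at s 1 +_) (at-suffixSums-1 (diffs k s)) ⟨
    x ∸ at s 1 + at (suffixSums (diffs k s)) 1    ≡⟨ cong (λ s′ → x ∸ at s 1 + at s′ 1) tail ⟩
    x ∸ at s 1 + at s 1                           ≡⟨ m∸n+n≡m (Chain-head k ch) ⟩
    x                                             ∎

fsWeight-map : ∀ (c : ℕ → ℕ) ts →
  fsWeight (map (λ t → (-[1+ 0 ] ℤ.+ ℤ.+ (2 * t)) , c t) ts)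
    ≡ ℤ.+ sum (map (λ t → suc (2 * t) * c t) ts) ℤ.- ℤ.+ (2 * sum (map c ts))
fsWeight-map c []       = refl
fsWeight-map c (t ∷ ts) = begin
  (-[1+ 0 ] ℤ.+ ℤ.+ (2 * t)) ℤ.* ℤ.+ c t ℤ.+ fsWeight (map (λ t → (-[1+ 0 ] ℤ.+ ℤ.+ (2 * t)) , c t) ts)
    ≡⟨ cong (λ x → (-[1+ 0 ] ℤ.+ ℤ.+ (2 * t)) ℤ.* ℤ.+ c t ℤ.+ x) (fsWeight-map c ts) ⟩
  (-[1+ 0 ] ℤ.+ ℤ.+ (2 * t)) ℤ.* ℤ.+ c t ℤ.+ (ℤ.+ P ℤ.- ℤ.+ (2 * Q))
    ≡⟨ cong (λ x → (-[1+ 0 ] ℤ.+ ℤ.+ (2 * t)) ℤ.* ℤ.+ c t ℤ.+ (ℤ.+ P ℤ.- x)) (ℤP.pos-* 2 Q) ⟩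
  (-[1+ 0 ] ℤ.+ ℤ.+ (2 * t)) ℤ.* ℤ.+ c t ℤ.+ (ℤ.+ P ℤ.- ℤ.+ 2 ℤ.* ℤ.+ Q)
    ≡⟨ rearrange (ℤ.+ (2 * t)) (ℤ.+ c t) (ℤ.+ P) (ℤ.+ Q) ⟩
  (ℤ.+ 1 ℤ.+ ℤ.+ (2 * t)) ℤ.* ℤ.+ c t ℤ.+ ℤ.+ P ℤ.- ℤ.+ 2 ℤ.* (ℤ.+ c t ℤ.+ ℤ.+ Q)
    ≡⟨ cong₂ (λ x y → x ℤ.+ ℤ.+ P ℤ.- y) (cast₁ (2 * t) (c t)) (cast₂ (c t) Q) ⟩
  ℤ.+ (suc (2 * t) * c t) ℤ.+ ℤ.+ P ℤ.- ℤ.+ (2 * (c t + Q))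
    ≡⟨ cong (λ x → x ℤ.- ℤ.+ (2 * (c t + Q))) (ℤP.pos-+ (suc (2 * t) * c t) P) ⟨
  ℤ.+ (suc (2 * t) * c t + P) ℤ.- ℤ.+ (2 * (c t + Q))
    ∎
  where
  P = sum (map (λ t → suc (2 * t) * c t) ts)
  Q = sum (map c ts)
  rearrange : ∀ T C P Q →
    (-[1+ 0 ] ℤ.+ T) ℤ.* C ℤ.+ (P ℤ.- ℤ.+ 2 ℤ.* Q) ≡ (ℤ.+ 1 ℤ.+ T) ℤ.* C ℤ.+ P ℤ.- ℤ.+ 2 ℤ.* (C ℤ.+ Q)
  rearrange = ℤ-Solver.solve-∀
  cast₁ : ∀ m c → (ℤ.+ 1 ℤ.+ ℤ.+ m) ℤ.* ℤ.+ c ≡ ℤ.+ (suc m * c)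
  cast₁ m c = trans (cong (λ x → x ℤ.* ℤ.+ c) (sym (ℤP.pos-+ 1 m))) (sym (ℤP.pos-* (suc m) c))
  cast₂ : ∀ c q → ℤ.+ 2 ℤ.* (ℤ.+ c ℤ.+ ℤ.+ q) ≡ ℤ.+ (2 * (c + q))
  cast₂ c q = trans (cong (λ x → ℤ.+ 2 ℤ.* x) (sym (ℤP.pos-+ c q))) (sym (ℤP.pos-* 2 (c + q)))

-- Entry 2t − 1 of fs₋₁ counts the m with t < s_m, so the frame weight is Σ_m Σ_{t < s_m} (2t − 1).
fsWeight-frame : ∀ {k} (λs : Tuple k) →
  fsWeight (fs -[1+ 0 ] λs)
    ≡ ℤ.+ ∑[ j < k ] (sAt λs (suc j) * sAt λs (suc j)) ℤ.- ℤ.+ (2 * ∑[ j < k ] sAt λs (suc j))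
fsWeight-frame {k} λs = begin
  fsWeight (fs -[1+ 0 ] λs)
    ≡⟨ fsWeight-map c (upTo S) ⟩
  ℤ.+ sum (map (λ t → suc (2 * t) * c t) (upTo S)) ℤ.- ℤ.+ (2 * sum (map c (upTo S)))
    ≡⟨ cong₂ (λ x y → ℤ.+ x ℤ.- ℤ.+ (2 * y)) (sum-map-upTo _ S) (sum-map-upTo c S) ⟩
  ℤ.+ ∑[ t < S ] (suc (2 * t) * c t) ℤ.- ℤ.+ (2 * ∑< S c)
    ≡⟨ cong₂ (λ x y → ℤ.+ x ℤ.- ℤ.+ (2 * y)) squares heights ⟩
  ℤ.+ ∑[ j < k ] (σ (suc j) * σ (suc j)) ℤ.- ℤ.+ (2 * ∑[ j < k ] σ (suc j))
    ∎
  where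
  σ = sAt λs
  S = σ 1
  c : ℕ → ℕ
  c t = length (filter (λ m → t <? σ m) (oneTo k))
  c-count : ∀ t → c t ≡ ∑[ j < k ] 𝟙< t (σ (suc j))
  c-count t = trans (length-filter (λ m → t <? σ m) (oneTo k)) (sum-map-oneTo (λ m → 𝟙< t (σ m)) k)
  σ≤S : ∀ j → σ (suc j) ≤ S
  σ≤S j = sum-drop-≤ (partLengths λs) j
  squares : ∑[ t < S ] (suc (2 * t) * c t) ≡ ∑[ j < k ] (σ (suc j) * σ (suc j))
  squares = begin
    ∑[ t < S ] (suc (2 * t) * c t)                          ≡⟨ ∑-cong S (λ t → cong (suc (2 * t) *_) (c-count t)) ⟩
    ∑[ t < S ] (suc (2 * t) * ∑[ j < k ] 𝟙< t (σ (suc j)))  ≡⟨ ∑-double-count (λ t → suc (2 * t)) (σ ∘ suc) k σ≤S ⟩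
    ∑[ j < k ] ∑[ t < σ (suc j) ] suc (2 * t)               ≡⟨ ∑-cong k (λ j → ∑-odd (σ (suc j))) ⟩
    ∑[ j < k ] (σ (suc j) * σ (suc j))                      ∎
  heights : ∑< S c ≡ ∑[ j < k ] σ (suc j)
  heights = begin
    ∑< S c                                                  ≡⟨ ∑-cong S (λ t → trans (c-count t) (sym (*-identityˡ _))) ⟩
    ∑[ t < S ] (1 * ∑[ j < k ] 𝟙< t (σ (suc j)))            ≡⟨ ∑-double-count (λ _ → 1) (σ ∘ suc) k σ≤S ⟩
    ∑[ j < k ] ∑[ t < σ (suc j) ] 1                         ≡⟨ ∑-cong k (λ j → trans (∑-const (σ (suc j)) 1) (*-identityʳ _)) ⟩
    ∑[ j < k ] σ (suc j)                                    ∎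

-- The lower bound and the exponent

module LowerBound (a b k : ℕ) (2a+2b≤k : 2 * a + 2 * b ≤ k) where

  K c : ℕ
  K = k ∸ 2 * b
  c = K ∸ 2 * a

  2a≤K : 2 * a ≤ K
  2a≤K = m+n≤o⇒m≤o∸n (2 * a) 2a+2b≤k

  2a+c≡K : 2 * a + c ≡ K
  2a+c≡K = m+[n∸m]≡n 2a≤K

  K+2b≡k : K + 2 * b ≡ k
  K+2b≡k = m∸n+n≡m (≤-trans (m≤n+m (2 * b) (2 * a)) 2a+2b≤k)

  β : ℕ → ℕ
  β = lowerBound a b k

  e : ℕ → ℕ
  e = evenCeil ∘ β

  β-low : ∀ {m} → m ≤ 2 * a → β m ≡ m
  β-low {m} m≤2a = begin
    m + (m ∸ 2 * a) + (m ∸ K)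
      ≡⟨ cong₂ (λ x y → m + x + y) (m≤n⇒m∸n≡0 m≤2a) (m≤n⇒m∸n≡0 (≤-trans m≤2a 2a≤K)) ⟩
    m + 0 + 0
      ≡⟨ trans (+-identityʳ _) (+-identityʳ m) ⟩
    m
      ∎

  β-mid : ∀ {u} → u ≤ c → β (2 * a + u) ≡ 2 * (a + u)
  β-mid {u} u≤c = begin
    2 * a + u + (2 * a + u ∸ 2 * a) + (2 * a + u ∸ K)
      ≡⟨ cong₂ (λ x y → 2 * a + u + x + y) (m+n∸m≡n (2 * a) u) (m≤n⇒m∸n≡0 2a+u≤K) ⟩
    2 * a + u + u + 0
      ≡⟨ rearrange a u ⟩
    2 * (a + u)
      ∎
    where
    2a+u≤K : 2 * a + u ≤ K
    2a+u≤K = ≤-trans (+-monoʳ-≤ (2 * a) u≤c) (≤-reflexive 2a+c≡K)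
    rearrange : ∀ a u → 2 * a + u + u + 0 ≡ 2 * (a + u)
    rearrange = ℕ-Solver.solve-∀

  β-high : ∀ t → β (K + t) ≡ 2 * (a + c) + 3 * t
  β-high t = begin
    K + t + (K + t ∸ 2 * a) + (K + t ∸ K)      ≡⟨ cong₂ (λ x y → K + t + x + y) K+t∸2a (m+n∸m≡n K t) ⟩
    K + t + (c + t) + t                        ≡⟨ cong (λ K′ → K′ + t + (c + t) + t) 2a+c≡K ⟨
    2 * a + c + t + (c + t) + t                ≡⟨ rearrange a c t ⟩
    2 * (a + c) + 3 * t                        ∎
    where
    K+t∸2a : K + t ∸ 2 * a ≡ c + t
    K+t∸2a = trans (cong (λ K′ → K′ + t ∸ 2 * a) (sym 2a+c≡K))
                   (trans (cong (_∸ 2 * a) (+-assoc (2 * a) c t)) (m+n∸m≡n (2 * a) (c + t)))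
    rearrange : ∀ a c t → 2 * a + c + t + (c + t) + t ≡ 2 * (a + c) + 3 * t
    rearrange = ℕ-Solver.solve-∀

  β-mono : ∀ m → β m ≤ β (suc m)
  β-mono m = +-mono-≤ (+-mono-≤ (n≤1+n m) (∸-monoˡ-≤ (2 * a) (n≤1+n m))) (∸-monoˡ-≤ K (n≤1+n m))

  e-mono : ∀ m → e m ≤ e (suc m)
  e-mono m = evenCeil-mono-≤ (β-mono m)

  e-0 : e 0 ≡ 0
  e-0 = cong evenCeil (cong₂ _+_ (0∸n≡0 (2 * a)) (0∸n≡0 K))

  2≤e : ∀ m → 2 ≤ e (suc m)
  2≤e m = evenCeil-mono-≤ {1} (≤-trans (s≤s z≤n) (≤-trans (m≤m+n (suc m) _) (m≤m+n _ _)))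

  e-low-even : ∀ {i} → 2 * i ≤ 2 * a → e (2 * i) ≡ 2 * i
  e-low-even {i} 2i≤2a = trans (cong evenCeil (β-low 2i≤2a)) (evenCeil-double i)

  e-low-odd : ∀ {i} → suc (2 * i) ≤ 2 * a → e (suc (2 * i)) ≡ 2 + 2 * i
  e-low-odd {i} 2i+1≤2a = trans (cong evenCeil (β-low 2i+1≤2a)) (evenCeil-suc-double i)

  e-mid : ∀ {u} → u ≤ c → e (2 * a + u) ≡ 2 * (a + u)
  e-mid {u} u≤c = trans (cong evenCeil (β-mid u≤c)) (evenCeil-double (a + u))

  e-high-even : ∀ i → e (K + 2 * i) ≡ 2 * (a + c + 3 * i)
  e-high-even i = trans (cong evenCeil (trans (β-high (2 * i)) (rearrange a c i))) (evenCeil-double (a + c + 3 * i))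
    where
    rearrange : ∀ a c i → 2 * (a + c) + 3 * (2 * i) ≡ 2 * (a + c + 3 * i)
    rearrange = ℕ-Solver.solve-∀

  e-high-odd : ∀ i → e (K + suc (2 * i)) ≡ 2 + 2 * (a + c + 3 * i + 1)
  e-high-odd i = trans (cong evenCeil (trans (β-high (suc (2 * i))) (rearrange a c i))) (evenCeil-suc-double (a + c + 3 * i + 1))
    where
    rearrange : ∀ a c i → 2 * (a + c) + 3 * suc (2 * i) ≡ suc (2 * (a + c + 3 * i + 1))
    rearrange = ℕ-Solver.solve-∀

  δ : ℕ → ℕ
  δ j = e (suc j) ∸ e j

  δ-low : ∀ {i} → i < a → δ (2 * i) ≡ 2 × δ (suc (2 * i)) ≡ 0
  δ-low {i} i<a = m≡n+o⇒m∸n≡o {n = e (2 * i)} (begin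
      e (suc (2 * i))           ≡⟨ e-low-odd {i} (≤-trans (n≤1+n (suc (2 * i))) 2i+2≤2a) ⟩
      2 + 2 * i                 ≡⟨ +-comm 2 (2 * i) ⟩
      2 * i + 2                 ≡⟨ cong (_+ 2) (e-low-even {i} (≤-trans (m≤n+m (2 * i) 2) 2i+2≤2a)) ⟨
      e (2 * i) + 2             ∎)
    , m≡n+o⇒m∸n≡o {n = e (suc (2 * i))} (begin
      e (suc (suc (2 * i)))     ≡⟨ cong e (*-suc 2 i) ⟨
      e (2 * suc i)             ≡⟨ e-low-even {suc i} (*-monoʳ-≤ 2 i<a) ⟩
      2 * suc i                 ≡⟨ *-suc 2 i ⟩
      2 + 2 * i                 ≡⟨ e-low-odd {i} (≤-trans (n≤1+n (suc (2 * i))) 2i+2≤2a) ⟨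
      e (suc (2 * i))           ≡⟨ +-identityʳ (e (suc (2 * i))) ⟨
      e (suc (2 * i)) + 0       ∎)
    where
    2i+2≤2a : 2 + 2 * i ≤ 2 * a
    2i+2≤2a = subst (_≤ 2 * a) (*-suc 2 i) (*-monoʳ-≤ 2 i<a)

  δ-mid : ∀ {i} → i < c → δ (2 * a + i) ≡ 2
  δ-mid {i} i<c = m≡n+o⇒m∸n≡o (begin
    e (suc (2 * a + i))   ≡⟨ cong e (+-suc (2 * a) i) ⟨
    e (2 * a + suc i)     ≡⟨ e-mid i<c ⟩
    2 * (a + suc i)       ≡⟨ rearrange a i ⟩
    2 * (a + i) + 2       ≡⟨ cong (_+ 2) (e-mid (<⇒≤ i<c)) ⟨
    e (2 * a + i) + 2     ∎)
    where
    rearrange : ∀ a i → 2 * (a + suc i) ≡ 2 * (a + i) + 2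
    rearrange = ℕ-Solver.solve-∀

  δ-high : ∀ i → δ (K + 2 * i) ≡ 4 × δ (suc (K + 2 * i)) ≡ 2
  δ-high i = m≡n+o⇒m∸n≡o {n = e (K + 2 * i)} (begin
      e (suc (K + 2 * i))            ≡⟨ cong e (+-suc K (2 * i)) ⟨
      e (K + suc (2 * i))            ≡⟨ e-high-odd i ⟩
      2 + 2 * (X + 1)                ≡⟨ rearrange₁ X ⟩
      2 * X + 4                      ≡⟨ cong (_+ 4) (e-high-even i) ⟨
      e (K + 2 * i) + 4              ∎)
    , m≡n+o⇒m∸n≡o {n = e (suc (K + 2 * i))} (begin
      e (suc (suc (K + 2 * i)))      ≡⟨ cong e K+2[i+1] ⟨
      e (K + 2 * suc i)              ≡⟨ e-high-even (suc i) ⟩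
      2 * (a + c + 3 * suc i)        ≡⟨ rearrange₂ a c i ⟩
      2 + 2 * (X + 1) + 2            ≡⟨ cong (_+ 2) (trans (cong e (sym (+-suc K (2 * i)))) (e-high-odd i)) ⟨
      e (suc (K + 2 * i)) + 2        ∎)
    where
    X = a + c + 3 * i
    K+2[i+1] : K + 2 * suc i ≡ suc (suc (K + 2 * i))
    K+2[i+1] = trans (cong (K +_) (*-suc 2 i)) (trans (+-suc K (suc (2 * i))) (cong suc (+-suc K (2 * i))))
    rearrange₁ : ∀ X → 2 + 2 * (X + 1) ≡ 2 * X + 4
    rearrange₁ = ℕ-Solver.solve-∀
    rearrange₂ : ∀ a c i → 2 * (a + c + 3 * suc i) ≡ 2 + 2 * (a + c + 3 * i + 1) + 2
    rearrange₂ = ℕ-Solver.solve-∀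

  ∑-segments : ∀ (f : ℕ → ℕ) → ∑< k f ≡ ∑< (2 * a) f + ∑[ i < c ] f (2 * a + i) + ∑[ i < 2 * b ] f (K + i)
  ∑-segments f = begin
    ∑< k f                                                              ≡⟨ cong (λ l → ∑< l f) K+2b≡k ⟨
    ∑< (K + 2 * b) f                                                    ≡⟨ ∑-+ f K (2 * b) ⟩
    ∑< K f + T                                                          ≡⟨ cong (λ l → ∑< l f + T) 2a+c≡K ⟨
    ∑< (2 * a + c) f + T                                                ≡⟨ cong (_+ T) (∑-+ f (2 * a) c) ⟩
    ∑< (2 * a) f + ∑[ i < c ] f (2 * a + i) + ∑[ i < 2 * b ] f (K + i)  ∎
    where T = ∑[ i < 2 * b ] f (K + i)

  increments-identity : ∀ (σ : ℕ → ℕ) →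
    ∑[ j < k ] (δ j * σ (suc j)) + 2 * ∑[ i < a ] σ (2 * suc i)
      ≡ 2 * ∑[ j < k ] σ (suc j) + 2 * ∑[ i < b ] σ (suc (K + 2 * i))
  increments-identity σ = begin
    ∑< k F + 2 * ∑[ i < a ] σ (2 * suc i)
      ≡⟨ cong₂ _+_ (∑-segments F) (sym (∑-distribˡ-* 2 (λ i → σ (2 * suc i)) a)) ⟩
    F₁ + F₂ + F₃ + H₁
      ≡⟨ rearrange F₁ F₂ F₃ H₁ ⟩
    (F₁ + H₁) + F₂ + F₃
      ≡⟨ cong₂ _+_ (cong₂ _+_ low middle) high ⟩
    G₁ + G₂ + (G₃ + H₃)
      ≡⟨ +-assoc (G₁ + G₂) G₃ H₃ ⟨
    G₁ + G₂ + G₃ + H₃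
      ≡⟨ cong₂ _+_ (sym (∑-segments G)) (∑-distribˡ-* 2 (λ i → σ (suc (K + 2 * i))) b) ⟩
    ∑< k G + 2 * ∑[ i < b ] σ (suc (K + 2 * i))
      ≡⟨ cong (_+ 2 * ∑[ i < b ] σ (suc (K + 2 * i))) (∑-distribˡ-* 2 (σ ∘ suc) k) ⟩
    2 * ∑[ j < k ] σ (suc j) + 2 * ∑[ i < b ] σ (suc (K + 2 * i))
      ∎
    where
    F G : ℕ → ℕ
    F j = δ j * σ (suc j)
    G j = 2 * σ (suc j)
    F₁ = ∑< (2 * a) F
    F₂ = ∑[ i < c ] F (2 * a + i)
    F₃ = ∑[ i < 2 * b ] F (K + i)
    G₁ = ∑< (2 * a) G
    G₂ = ∑[ i < c ] G (2 * a + i)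
    G₃ = ∑[ i < 2 * b ] G (K + i)
    H₁ = ∑[ i < a ] (2 * σ (2 * suc i))
    H₃ = ∑[ i < b ] (2 * σ (suc (K + 2 * i)))
    rearrange : ∀ x y z w → x + y + z + w ≡ (x + w) + y + z
    rearrange = ℕ-Solver.solve-∀

    low : F₁ + H₁ ≡ G₁
    low = trans (∑-pairs-cong F G (λ i → 2 * σ (2 * suc i)) (λ _ → 0) a pair)
                (trans (cong (G₁ +_) (∑-zero a (λ _ → refl))) (+-identityʳ G₁))
      where
      pair : ∀ i → i < a → F (2 * i) + F (suc (2 * i)) + 2 * σ (2 * suc i) ≡ G (2 * i) + G (suc (2 * i)) + 0
      pair i i<a = begin
        δ (2 * i) * x + δ (suc (2 * i)) * y + 2 * σ (2 * suc i)
          ≡⟨ cong (λ z → δ (2 * i) * x + δ (suc (2 * i)) * y + 2 * σ z) (*-suc 2 i) ⟩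
        δ (2 * i) * x + δ (suc (2 * i)) * y + 2 * y
          ≡⟨ cong₂ (λ d d′ → d * x + d′ * y + 2 * y) (proj₁ (δ-low i<a)) (proj₂ (δ-low i<a)) ⟩
        2 * x + 0 * y + 2 * y
          ≡⟨ simplify x y ⟩
        2 * x + 2 * y + 0
          ∎
        where
        x = σ (suc (2 * i))
        y = σ (suc (suc (2 * i)))
        simplify : ∀ x y → 2 * x + 0 * y + 2 * y ≡ 2 * x + 2 * y + 0
        simplify = ℕ-Solver.solve-∀

    middle : F₂ ≡ G₂
    middle = ∑-cong-< c (λ i i<c → cong (_* σ (suc (2 * a + i))) (δ-mid i<c))

    high : F₃ ≡ G₃ + H₃
    high = trans (sym (+-identityʳ F₃))
                 (trans (cong (F₃ +_) (sym (∑-zero b (λ _ → refl))))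
                        (∑-pairs-cong (F ∘ (K +_)) (G ∘ (K +_)) (λ _ → 0) (λ i → 2 * σ (suc (K + 2 * i))) b pair))
      where
      pair : ∀ i → i < b →
        F (K + 2 * i) + F (K + suc (2 * i)) + 0 ≡ G (K + 2 * i) + G (K + suc (2 * i)) + 2 * σ (suc (K + 2 * i))
      pair i _ = begin
        F (K + 2 * i) + F (K + suc (2 * i)) + 0
          ≡⟨ cong (λ j → F (K + 2 * i) + F j + 0) (+-suc K (2 * i)) ⟩
        δ (K + 2 * i) * x + δ (suc (K + 2 * i)) * y + 0
          ≡⟨ cong₂ (λ d d′ → d * x + d′ * y + 0) (proj₁ (δ-high i)) (proj₂ (δ-high i)) ⟩
        4 * x + 2 * y + 0
          ≡⟨ simplify x y ⟩
        2 * x + 2 * y + 2 * x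
          ≡⟨ cong (λ j → 2 * x + G j + 2 * x) (+-suc K (2 * i)) ⟨
        G (K + 2 * i) + G (K + suc (2 * i)) + 2 * σ (suc (K + 2 * i))
          ∎
        where
        x = σ (suc (K + 2 * i))
        y = σ (suc (suc (K + 2 * i)))
        simplify : ∀ x y → 4 * x + 2 * y + 0 ≡ 2 * x + 2 * y + 2 * x
        simplify = ℕ-Solver.solve-∀

  module _ {M s} (ch : Chain k M s) where

    private
      σ : ℕ → ℕ
      σ = at s
      squares heights base : ℕ
      squares = ∑[ j < k ] (σ (suc j) * σ (suc j))
      heights = ∑[ j < k ] σ (suc j)
      base    = weightedSum e (diffs k s)

    base-by-parts : base ≡ ∑[ j < k ] (δ j * σ (suc j))
    base-by-parts = begin
      base                            ≡⟨ weightedSum-oneTo e (λ j → σ j ∸ σ (suc j)) k ⟩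
      B                               ≡⟨ +-identityʳ B ⟨
      B + 0                           ≡⟨ cong (B +_) (trans (cong (e k *_) (at-beyond k ch k ≤-refl)) (*-zeroʳ (e k))) ⟨
      B + e k * σ (suc k)             ≡⟨ ∑-by-parts e σ k e-mono (at-antitone k ch) e-0 ⟩
      ∑[ j < k ] (δ j * σ (suc j))    ∎
      where
      B = ∑[ j < k ] (e (suc j) * (σ (suc j) ∸ σ (suc (suc j))))

    expo-≡ : expo a b k s ≡ ℤ.+ (squares + base) ℤ.- ℤ.+ (2 * heights)
    expo-≡ = begin
      expo a b k s
        ≡⟨ cong₂ (λ x y → x ℤ.+ ℤ.+ (2 * y)) (cong₂ (λ x y → ℤ.+ x ℤ.- ℤ.+ (2 * y)) (sum-map-oneTo (λ i → σ i * σ i) k)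
                                                                                    (sum-map-oneTo (λ i → σ (2 * i)) a))
                                            beyondK ⟩
      ℤ.+ squares ℤ.- ℤ.+ (2 * A₂) ℤ.+ ℤ.+ (2 * A₃)
        ≡⟨ pos-rebalance squares {base} {2 * A₂} {2 * heights} {2 * A₃}
             (trans (cong (_+ 2 * A₂) base-by-parts) (increments-identity σ)) ⟩
      ℤ.+ (squares + base) ℤ.- ℤ.+ (2 * heights)
        ∎
      where
      A₂ = ∑[ i < a ] σ (2 * suc i)
      A₃ = ∑[ i < b ] σ (suc (K + 2 * i))
      beyondK : sum (map (λ i → at s ((k ∸ 2 * b) + 2 * i ∸ 1)) (oneTo b)) ≡ A₃
      beyondK = trans (sum-map-oneTo (λ i → σ (K + 2 * i ∸ 1)) b) (∑-cong b (λ i → cong (λ j → σ (j ∸ 1)) (index i)))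
        where
        index : ∀ i → K + 2 * suc i ≡ suc (suc (K + 2 * i))
        index i = trans (cong (K +_) (*-suc 2 i)) (trans (+-suc K (suc (2 * i))) (cong suc (+-suc K (2 * i))))

    expo-lower-bound : ℤ.+ (2 * σ 1) ℤ.≤ expo a b k s ℤ.+ ℤ.+ k
    expo-lower-bound = subst (ℤ.+ (2 * σ 1) ℤ.≤_) (cong (ℤ._+ ℤ.+ k) (sym expo-≡)) (pos-≤-rebalance bound)
      where
      2s₁≤base : 2 * σ 1 ≤ base
      2s₁≤base = subst (λ x → 2 * x ≤ base) sum-diffs (weightedSum-≥ e 2≤e (diffs k s))
        where
        sum-diffs : sum (diffs k s) ≡ σ 1
        sum-diffs = trans (sym (at-suffixSums-1 (diffs k s))) (cong (λ s′ → at s′ 1) (suffixSums-diffs k ch))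
      2heights≤squares+k : 2 * heights ≤ squares + k
      2heights≤squares+k = subst₂ _≤_ (∑-distribˡ-* 2 (σ ∘ suc) k) squares+k (∑-mono-≤ k (λ j → 2*n≤n*n+1 (σ (suc j))))
        where
        squares+k : ∑[ j < k ] (σ (suc j) * σ (suc j) + 1) ≡ squares + k
        squares+k = trans (∑-distrib-+ k) (cong (squares +_) (trans (∑-const k 1) (*-identityʳ k)))
      bound : 2 * σ 1 + 2 * heights ≤ squares + base + k
      bound = ≤-trans (+-mono-≤ 2s₁≤base 2heights≤squares+k) (≤-reflexive (rearrange base squares k))
        where
        rearrange : ∀ r a k → r + (a + k) ≡ a + r + k
        rearrange = ℕ-Solver.solve-∀

    weight-tupleFromGaps : ∀ {rss} → map length rss ≡ diffs k s →
      weight (tupleFromGaps β k rss) ≡ expo a b k s ℤ.+ ℤ.+ grade (termClass (diffs k s)) rss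
    weight-tupleFromGaps {rss} lengths = begin
      ℤ.+ sum (map size (V.toList λs)) ℤ.+ fsWeight (fs -[1+ 0 ] λs)
        ≡⟨ cong₂ ℤ._+_ (cong ℤ.+_ sizes) (fsWeight-frame λs) ⟩
      ℤ.+ (base + W) ℤ.+ (ℤ.+ ∑[ j < k ] (sAt λs (suc j) * sAt λs (suc j)) ℤ.- ℤ.+ (2 * ∑[ j < k ] sAt λs (suc j)))
        ≡⟨ cong₂ (λ x y → ℤ.+ (base + W) ℤ.+ (ℤ.+ x ℤ.- ℤ.+ (2 * y)))
                 (∑-cong k (λ j → cong₂ _*_ (frame j) (frame j))) (∑-cong k frame) ⟩
      ℤ.+ (base + W) ℤ.+ (ℤ.+ squares ℤ.- ℤ.+ (2 * heights))
        ≡⟨ cong (λ x → x ℤ.+ (ℤ.+ squares ℤ.- ℤ.+ (2 * heights))) (ℤP.pos-+ base W) ⟩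
      ℤ.+ base ℤ.+ ℤ.+ W ℤ.+ (ℤ.+ squares ℤ.- ℤ.+ (2 * heights))
        ≡⟨ rearrange (ℤ.+ base) (ℤ.+ W) (ℤ.+ squares) (ℤ.+ (2 * heights)) ⟩
      ℤ.+ squares ℤ.+ ℤ.+ base ℤ.- ℤ.+ (2 * heights) ℤ.+ ℤ.+ W
        ≡⟨ cong (λ x → x ℤ.- ℤ.+ (2 * heights) ℤ.+ ℤ.+ W) (ℤP.pos-+ squares base) ⟨
      ℤ.+ (squares + base) ℤ.- ℤ.+ (2 * heights) ℤ.+ ℤ.+ W
        ≡⟨ cong (ℤ._+ ℤ.+ W) expo-≡ ⟨
      expo a b k s ℤ.+ ℤ.+ W
        ∎
      where
      λs = tupleFromGaps β k rss
      W  = grade (termClass (diffs k s)) rss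
      length-rss : length rss ≡ k
      length-rss = lengths≡diffs⇒length≡ k s lengths
      sizes : sum (map size (V.toList λs)) ≡ base + W
      sizes = trans (sum-sizes-tupleFromGaps β k rss length-rss)
                    (cong (λ ls → weightedSum e ls + grade (termClass ls) rss) lengths)
      frame : ∀ j → sAt λs (suc j) ≡ σ (suc j)
      frame j = begin
        sum (drop j (partLengths λs))           ≡⟨ cong (sum ∘ drop j) (trans (partLengths-tupleFromGaps β k rss length-rss) lengths) ⟩
        sum (drop j (diffs k s))                ≡⟨ sum-drop (diffs k s) j ⟩
        at (suffixSums (diffs k s)) (suc j)     ≡⟨ cong (λ s′ → at s′ (suc j)) (suffixSums-diffs k ch) ⟩
        σ (suc j)                               ∎
      rearrange : ∀ R W A Q → R ℤ.+ W ℤ.+ (A ℤ.- Q) ≡ A ℤ.+ R ℤ.- Q ℤ.+ W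
      rearrange = ℤ-Solver.solve-∀

module Enumeration (a b k : ℕ) (2a+2b≤k : 2 * a + 2 * b ≤ k) (n : ℤ) where

  open LowerBound a b k 2a+2b≤k

  E : List ℕ → ℤ
  E s = expo a b k s

  N : ℕ
  N = ∣ n ∣ + k

  head-bounded : ∀ {M s} → Chain k M s → E s ℤ.≤ n → at s 1 ≤ N
  head-bounded {s = s} ch E≤n = ≤-trans (m≤n*m (at s 1) 2) (ℤP.drop‿+≤+ (ℤP.≤-trans (expo-lower-bound ch) E+k≤N))
    where
    E+k≤N : E s ℤ.+ ℤ.+ k ℤ.≤ ℤ.+ N
    E+k≤N = subst (E s ℤ.+ ℤ.+ k ℤ.≤_) (sym (ℤP.pos-+ ∣ n ∣ k)) (ℤP.+-monoˡ-≤ (ℤ.+ k) (ℤP.≤-trans E≤n (i≤+∣i∣ n)))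

  fibre : (s : List ℕ) → Dec (E s ℤ.≤ n) → List (Tuple k)
  fibre s (yes _) = map (tupleFromGaps β k) (enum (termClass (diffs k s)) ∣ n ℤ.- E s ∣)
  fibre s (no _)  = []

  fibreAt : List ℕ → List (Tuple k)
  fibreAt s = fibre s (E s ℤ.≤? n)

  tuples : List (Tuple k)
  tuples = concatMap fibreAt (chains k N)

  length-fibreAt : ∀ s → length (fibreAt s) ≡ termCoeff a b k s n
  length-fibreAt s with E s ℤ.≤? n
  ... | yes _ = trans (length-map (tupleFromGaps β k) (enum C w)) (length-enum C w)
    where
    C = termClass (diffs k s)
    w = ∣ n ℤ.- E s ∣
  ... | no  _ = refl

  length-tuples : length tuples ≡ rhsTrunc a b k N n
  length-tuples = trans (length-concatMap fibreAt (chains k N))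
                        (cong sum (map-cong-local {xs = chains k N} (All.tabulate (λ {s} _ → length-fibreAt s))))

  rhsTrunc-stable : ∀ {M} → N ≤ M → rhsTrunc a b k M n ≡ rhsTrunc a b k N n
  rhsTrunc-stable N≤M = sum-chains-stable k (λ s → termCoeff a b k s n) N≤M vanish
    where
    vanish : ∀ {L s} → Chain k L s → N < at s 1 → termCoeff a b k s n ≡ 0
    vanish {s = s} ch N<s₁ = cong (λ b → if b then series (termClass (diffs k s)) ∣ n ℤ.- E s ∣ else 0)
                                  (dec-false (E s ℤ.≤? n) (λ E≤n → <⇒≱ N<s₁ (head-bounded ch E≤n)))

  ∈-fibreAt⁻ : ∀ {s t} → t ∈ fibreAt s → ∃ λ rss →
    E s ℤ.≤ n × map length rss ≡ diffs k s × grade (termClass (diffs k s)) rss ≡ ∣ n ℤ.- E s ∣ × t ≡ tupleFromGaps β k rss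
  ∈-fibreAt⁻ {s} t∈ with E s ℤ.≤? n
  ... | yes E≤n with ∈-map⁻ (tupleFromGaps β k) t∈
  ...   | rss , rss∈ , refl with enum-sound (termClass (diffs k s)) rss∈
  ...     | valid , grade≡ = rss , E≤n , Equivalence.to (valid-termClass⇔ (diffs k s) rss) valid , grade≡ , refl

  ∈-fibreAt⁺ : ∀ {s rss} → E s ℤ.≤ n → map length rss ≡ diffs k s → grade (termClass (diffs k s)) rss ≡ ∣ n ℤ.- E s ∣ →
    tupleFromGaps β k rss ∈ fibreAt s
  ∈-fibreAt⁺ {s} {rss} E≤n lengths grade≡ with E s ℤ.≤? n
  ... | yes _  = ∈-map⁺ (tupleFromGaps β k) (subst (λ w → rss ∈ enum (termClass (diffs k s)) w) grade≡
                   (enum-complete (termClass (diffs k s)) (Equivalence.from (valid-termClass⇔ (diffs k s) rss) lengths)))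
  ... | no E≰n = contradiction E≤n E≰n

  tuples-sound : ∀ {t} → t ∈ tuples → InX a b k t × weight t ≡ n
  tuples-sound t∈ with ∈-concatMap⁻′ fibreAt t∈
  ... | s , s∈ , t∈fibre with ∈-fibreAt⁻ t∈fibre
  ...   | rss , E≤n , lengths , grade≡ , refl = tupleFromGaps-evenPartsAbove β k rss , (begin
    weight (tupleFromGaps β k rss)                     ≡⟨ weight-tupleFromGaps (chains-sound k N s∈) lengths ⟩
    E s ℤ.+ ℤ.+ grade (termClass (diffs k s)) rss      ≡⟨ cong (λ w → E s ℤ.+ ℤ.+ w) grade≡ ⟩
    E s ℤ.+ ℤ.+ ∣ n ℤ.- E s ∣                          ≡⟨ cong (λ x → E s ℤ.+ x) (ℤP.0≤i⇒+∣i∣≡i (ℤP.i≤j⇒0≤j-i E≤n)) ⟩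
    E s ℤ.+ (n ℤ.- E s)                                ≡⟨ cancel (E s) n ⟩
    n                                                  ∎)
    where
    cancel : ∀ x y → x ℤ.+ (y ℤ.- x) ≡ y
    cancel = ℤ-Solver.solve-∀

  tuples-complete : ∀ {t} → InX a b k t → weight t ≡ n → t ∈ tuples
  tuples-complete {t} inX weight≡n = subst (_∈ tuples) rebuild
    (∈-concatMap⁺′ fibreAt (chains-complete k N (Chain-weaken k ch (head-bounded ch E≤n))) (∈-fibreAt⁺ E≤n lengths grade≡))
    where
    rss = tupleGaps β t
    s   = suffixSums (partLengths t)
    W   = grade (termClass (diffs k s)) rss
    length-partLengths : length (partLengths t) ≡ k
    length-partLengths = trans (length-map length (V.toList t)) (VecP.length-toList t)
    ch : Chain k (sum (partLengths t)) s
    ch = subst (λ l → Chain l (sum (partLengths t)) s) length-partLengths (suffixSums-chain (partLengths t) ≤-refl)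
    lengths : map length rss ≡ diffs k s
    lengths = trans (lengths-tupleGaps β t)
                    (sym (subst (λ l → diffs l s ≡ partLengths t) length-partLengths (diffs-suffixSums (partLengths t))))
    rebuild : tupleFromGaps β k rss ≡ t
    rebuild = tupleFromGaps-tupleGaps β k t inX
    n≡E+W : n ≡ E s ℤ.+ ℤ.+ W
    n≡E+W = trans (sym weight≡n) (trans (cong weight (sym rebuild)) (weight-tupleFromGaps ch lengths))
    E≤n : E s ℤ.≤ n
    E≤n = subst (E s ℤ.≤_) (sym n≡E+W) (ℤP.i≤i+j (E s) (ℤ.+ W))
    grade≡ : W ≡ ∣ n ℤ.- E s ∣
    grade≡ = sym (cong ∣_∣ (trans (cong (λ x → x ℤ.- E s) n≡E+W) (cancel (E s) (ℤ.+ W))))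
      where
      cancel : ∀ x y → x ℤ.+ y ℤ.- x ≡ y
      cancel = ℤ-Solver.solve-∀

  tuples-unique : Unique tuples
  tuples-unique = unique-concatMap fibreAt (chains-unique k N) (λ {s} _ → fibre-unique s) same-chain
    where
    chain-of : ∀ {s t} → s ∈ chains k N → t ∈ fibreAt s → suffixSums (partLengths t) ≡ s
    chain-of {s} s∈ t∈ with ∈-fibreAt⁻ t∈
    ... | rss , _ , lengths , _ , refl = trans
      (cong suffixSums (trans (partLengths-tupleFromGaps β k rss (lengths≡diffs⇒length≡ k s lengths)) lengths))
      (suffixSums-diffs k (chains-sound k N s∈))
    same-chain : ∀ {s s′ t} → s ∈ chains k N → s′ ∈ chains k N → t ∈ fibreAt s → t ∈ fibreAt s′ → s ≡ s′
    same-chain s∈ s′∈ t∈ t∈′ = trans (sym (chain-of s∈ t∈)) (chain-of s′∈ t∈′)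
    fibre-unique : ∀ s → Unique (fibreAt s)
    fibre-unique s with E s ℤ.≤? n
    ... | yes _ = unique-map (tupleFromGaps β k) injective (enum-unique C w)
      where
      C = termClass (diffs k s)
      w = ∣ n ℤ.- E s ∣
      gaps-of : ∀ {rss} → rss ∈ enum C w → tupleGaps β (tupleFromGaps β k rss) ≡ rss
      gaps-of {rss} rss∈ = tupleGaps-tupleFromGaps β k rss
        (lengths≡diffs⇒length≡ k s (Equivalence.to (valid-termClass⇔ (diffs k s) rss) (proj₁ (enum-sound C rss∈))))
      injective : ∀ {x y} → x ∈ enum C w → y ∈ enum C w → tupleFromGaps β k x ≡ tupleFromGaps β k y → x ≡ y
      injective x∈ y∈ eq = trans (sym (gaps-of x∈)) (trans (cong (tupleGaps β) eq) (gaps-of y∈))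
    ... | no _  = []

proposition4p2 : (a b k : ℕ) → 2 * a + 2 * b ≤ k → (n : ℤ) →
    Σ (List (Tuple k)) (λ L →
    Unique L
    × ((λs : Tuple k) → (λs ∈ L) ⇔ (InX a b k λs × weight λs ≡ n))
    × ∃ (λ N → (M : ℕ) → N ≤ M → rhsTrunc a b k M n ≡ length L))
proposition4p2 a b k 2a+2b≤k n =
  tuples , tuples-unique , (λ t → mk⇔ tuples-sound λ (inX , w) → tuples-complete inX w) ,
  N , λ M N≤M → trans (rhsTrunc-stable N≤M) (sym length-tuples)
  where open Enumeration a b k 2a+2b≤k n
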